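{- Let $P$ be a finite graded bounded poset of rank $r\ge1$, and write its $\chi$-Chow polynomial as $\mathrm{H}_P(x)=\sum_{i=0}^{\lfloor(r-1)/2\rfloor}\gamma_i\,x^i(1+x)^{r-1-2i}$ with $\gamma_i\in\mathbb{Z}$, and set $\gamma_P(x)=\sum_i\gamma_ix^i$. Then $$\gamma_P(x)=\sum_{S\subseteq[r-1],\ S\text{ good}}\beta_P(S)\,x^{|S|}.$$
   Context: For a finite graded bounded poset $P$ with rank function $\rho$ ($\rho_{st}=\rho(t)-\rho(s)$, rank $r=\rho(\widehat1)$), the characteristic function is $\chi_{st}(x)=\sum_{s\le w\le t}\mu_{sw}x^{\rho_{wt}}$ (Möbius function $\mu$), an element of the incidence algebra (maps $[s,t]\mapsto a_{st}(x)\in\mathbb{Z}[x]$ with product $(ab)_{st}=\sum_{s\le w\le t}a_{sw}b_{wt}$). For $s<t$, $\chi_{st}$ is divisible by $x-1$; let $\overline{\chi}_{st}=\chi_{st}/(x-1)$ for $s<t$ and $\overline{\chi}_{ss}=-1$. The $\chi$-Chow function is $\mathrm{H}=-(\overline{\chi})^{ -1}$ and $\mathrm{H}_P=\mathrm{H}_{\widehat0\widehat1}$; $\mathrm{H}_P$ is symmetric with center $(r-1)/2$, so the $\gamma_i$ exist uniquely. For $S=\{s_1<\dots<s_m\}\subseteq[r-1]=\{1,\dots,r-1\}$, the flag $f$-vector $\alpha_P(S)$ is the number of chains $w_1<\dots<w_m$ in $P$ with $\rho(w_i)=s_i$; the flag $h$-vector is $\beta_P(S)=\sum_{T\subseteq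 S}(-1)^{|S|-|T|}\alpha_P(T)$. A set $S\subseteq\mathbb{Z}$ is good if it contains neither $1$ nor two consecutive integers. -}

module Defs where

open import Data.Nat as ℕ using (ℕ; zero; suc; _∸_; _≡ᵇ_; _/_; _≤ᵇ_)
open import Data.Integer as ℤ using (ℤ; +_; -_; _*_; _^_)
open import Data.Bool using (Bool; true; false; if_then_else_; not; _∧_)
open import Data.Fin using (Fin)
open import Data.List using (List; []; _∷_; map; foldr; filter; _++_; length; upTo; allFin; filterᵇ)
open import Data.Bool.ListAction using (any; all)
open import Data.Sum using (_⊎_)
open import Relation.Nullary using (¬_; Dec; does)
open import Relation.Nullary.Decidable using (_×-dec_; ¬?)
open import Relation.Binary using (IsDecPartialOrder)
open import Relation.Binary.PropositionalEquality using (_≡_)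

-- Polynomials in ℤ[x], represented by their coefficient functions
-- (coefficient of x^k).  All polynomials built below have finite support.

Poly : Set
Poly = ℕ → ℤ

_≈P_ : Poly → Poly → Set
p ≈P q = ∀ k → p k ≡ q k

sumℤ : List ℤ → ℤ
sumℤ = foldr ℤ._+_ (+ 0)

0P : Poly
0P _ = + 0

constP : ℤ → Poly
constP c zero    = c
constP c (suc _) = + 0

xP^ : ℕ → Poly
xP^ m k = if m ≡ᵇ k then + 1 else + 0

_+P_ : Poly → Poly → Poly
(p +P q) k = p k ℤ.+ q k

negP : Poly → Poly
negP p k = - p k

_*P_ : Poly → Poly → Poly
(p *P q) k = sumℤ (map (λ j → p j * q (k ∸ j)) (upTo (suc k)))

_^P_ : Poly → ℕ → Poly
p ^P zero  = constP (+ 1)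
p ^P suc m = p *P (p ^P m)

onePlusX : Poly
onePlusX = constP (+ 1) +P xP^ 1

sumP : List Poly → Poly
sumP = foldr _+P_ 0P

-- Exact division by (x - 1): if p = (x-1) q then q_k = -(p_0 + ... + p_k).
divXm1 : Poly → Poly
divXm1 p k = - sumℤ (map p (upTo (suc k)))

record GradedBoundedPoset : Set₁ where
  field
    n          : ℕ
    _≼_        : Fin n → Fin n → Set
    isDecPO    : IsDecPartialOrder _≡_ _≼_
    bot top    : Fin n
    bot-least  : ∀ x → bot ≼ x
    top-great  : ∀ x → x ≼ top
    ρ          : Fin n → ℕ
    ρ-bot      : ρ bot ≡ 0
    ρ-cover    : ∀ s t → s ≼ t → ¬ (s ≡ t)
                 → (∀ w → s ≼ w → w ≼ t → (w ≡ s) ⊎ (w ≡ t))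
                 → ρ t ≡ suc (ρ s)

module _ (P : GradedBoundedPoset) where
  open GradedBoundedPoset P
  open IsDecPartialOrder isDecPO using (_≟_; _≤?_)

  rank : ℕ
  rank = ρ top

  closedInt : Fin n → Fin n → List (Fin n)
  closedInt s t = filter (λ w → (s ≤? w) ×-dec (w ≤? t)) (allFin n)

  halfOpenInt : Fin n → Fin n → List (Fin n)
  halfOpenInt s t = filter (λ w → (s ≤? w) ×-dec (w ≤? t) ×-dec ¬? (w ≟ t)) (allFin n)

  -- Möbius function, by the recursion μ_ss = 1, μ_st = -Σ_{s≤w<t} μ_sw
  -- (fuel: chains have fewer than n+1 elements), and 0 if s ≰ t.
  möbiusF : ℕ → Fin n → Fin n → ℤ
  möbiusF zero    s t = + 0
  möbiusF (suc f) s t =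
    if does (s ≟ t) then + 1
    else if does (s ≤? t) then - sumℤ (map (λ w → möbiusF f s w) (halfOpenInt s t))
    else + 0

  μ : Fin n → Fin n → ℤ
  μ = möbiusF (suc n)

  χ : Fin n → Fin n → Poly
  χ s t = sumP (map (λ w → constP (μ s w) *P xP^ (ρ t ∸ ρ w)) (closedInt s t))

  χbar : Fin n → Fin n → Poly
  χbar s t = if does (s ≟ t) then constP (- + 1) else divXm1 (χ s t)

  -- The inverse in the incidence algebra of a function a with a_tt = -1:
  -- b_ss = -1 and, for s < t, from Σ_{s≤w≤t} b_sw a_wt = 0,
  -- b_st = Σ_{s≤w<t} b_sw a_wt.  (fuel as for μ)
  invF : (Fin n → Fin n → Poly) → ℕ → Fin n → Fin n → Poly
  invF a zero    s t = 0P
  invF a (suc f) s t =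
    if does (s ≟ t) then constP (- + 1)
    else if does (s ≤? t) then sumP (map (λ w → invF a f s w *P a w t) (halfOpenInt s t))
    else 0P

  χbarInv : Fin n → Fin n → Poly
  χbarInv = invF χbar (suc n)

  Hfun : Fin n → Fin n → Poly
  Hfun s t = negP (χbarInv s t)

  H : Poly
  H = Hfun bot top

  -- flag f- and h-vectors.  Subsets S ⊆ [r-1] are strictly increasing lists.

  chainsFrom : Fin n → List ℕ → ℕ
  chainsFrom w []      = 1
  chainsFrom w (s ∷ S) =
    foldr ℕ._+_ 0 (map (λ v → chainsFrom v S)
      (filter (λ v → (w ≤? v) ×-dec ¬? (w ≟ v) ×-dec (ρ v ℕ.≟ s)) (allFin n)))

  α : List ℕ → ℕ
  α []      = 1
  α (s ∷ S) = foldr ℕ._+_ 0 (map (λ v → chainsFrom v S)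
                (filter (λ v → ρ v ℕ.≟ s) (allFin n)))

-- all sublists (= all subsets of a strictly increasing list, each once,
-- again strictly increasing)
sublists : {A : Set} → List A → List (List A)
sublists []       = [] ∷ []
sublists (x ∷ xs) = sublists xs ++ map (x ∷_) (sublists xs)

range1 : ℕ → List ℕ
range1 r = map suc (upTo (r ∸ 1))

elemℕ : ℕ → List ℕ → Bool
elemℕ i S = any (i ≡ᵇ_) S

good : List ℕ → Bool
good S = not (elemℕ 1 S) ∧ all (λ i → not (elemℕ (suc i) S)) S

module _ (P : GradedBoundedPoset) where

  β : List ℕ → ℤ
  β S = sumℤ (map (λ T → ((- + 1) ^ (length S ∸ length T)) * + α P T) (sublists S))

  goodPoly : Poly
  goodPoly k = sumℤ (map (β)
                 (filterᵇ (λ S → good S ∧ (length S ≡ᵇ k)) (sublists (range1 (rank P)))))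

gammaExpansion : ℕ → (ℕ → ℤ) → Poly
gammaExpansion r γ =
  sumP (map (λ i → constP (γ i) *P (xP^ i *P (onePlusX ^P (r ∸ 1 ∸ 2 ℕ.* i))))
            (upTo (suc ((r ∸ 1) / 2))))

gammaPoly : ℕ → (ℕ → ℤ) → Poly
gammaPoly r γ k = if k ≤ᵇ ((r ∸ 1) / 2) then γ k else + 0

module Submission where

-- H is minus the inverse of χ̄ in the incidence algebra, and multiplying by ζ gives
-- H(s,1̂) = 1 + Σ_{s<u≤1̂} (x + ⋯ + x^(ρ(s,u)−1)) H(u,1̂).  Unfolding this recursion writes H_P
-- as a sum over chains, i.e. over rank sets S ⊆ [r−1] weighted by α_P(S) and by a product of one
-- polynomial per gap between consecutive ranks.  Substituting α = Σ β and summing over all S ⊇ T,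
-- the weight of β_P(T) factorises over the gaps of T: x(1+x)^(d−2) for an inner gap of length d
-- and (1+x)^(d−1) for the last one.  This vanishes exactly when T has a gap of length one, i.e.
-- when T is not good, and is x^|T| (1+x)^(r−1−2|T|) otherwise; uniqueness of the γ-expansion
-- then identifies the coefficients.

open import Defs
open import Algebra.Bundles using (CommutativeMonoid; CommutativeSemiring; CommutativeRing)
import Algebra.Properties.CommutativeSemigroup as CommutativeSemigroupProperties
import Algebra.Properties.Group as GroupProperties
import Algebra.Properties.Ring as RingProperties
open import Data.Bool using (Bool; true; false; if_then_else_; not; _∧_; _∨_) renaming (T to Tᵇ)
open import Data.Bool.ListAction using (all)
open import Data.Bool.Properties using (∨-identityʳ)
open import Data.Empty using (⊥-elim)
open import Data.Fin using (Fin)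
open import Data.Fin.Properties using (any?)
open import Data.Integer as ℤ using (ℤ; +_)
import Data.Integer.Properties as ℤP
open import Data.Integer.Tactic.RingSolver using (solve-∀)
open import Data.List using (List; []; _∷_; _++_; map; foldr; filter; filterᵇ; length; upTo; applyUpTo; allFin)
import Data.List.Properties as ListP
open import Data.List.Membership.Propositional using (_∈_)
open import Data.List.Membership.Propositional.Properties
  using (∈-++⁻; ∈-map⁻; ∈-filter⁻; ∈-allFin; ∈-upTo⁺; ∈-upTo⁻)
open import Data.List.Relation.Unary.All as All using (All; []; _∷_)
open import Data.List.Relation.Unary.AllPairs using ([]; _∷_)
open import Data.List.Relation.Unary.Any using (here; there)
open import Data.List.Relation.Unary.Unique.Propositional using (Unique)
open import Data.List.Relation.Unary.Unique.Propositional.Properties using (allFin⁺; upTo⁺)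
open import Data.Nat as ℕ using (ℕ; zero; suc; pred; _∸_; _<_; _≤_; _<ᵇ_; _≡ᵇ_)
open import Data.Nat.DivMod using (_/_; m*n/n≡m; /-monoˡ-≤)
open import Data.Nat.Induction using (<-wellFounded)
import Data.Nat.Properties as ℕP
import Algebra.Construct.Pointwise ℕ as Pointwise
open import Data.Product using (_×_; _,_; proj₁; proj₂)
open import Data.Sum using (_⊎_; inj₁; inj₂)
open import Data.Unit using (tt)
open import Function using (_∘_; _∘′_; _⇔_; mk⇔; Equivalence)
open import Induction.WellFounded using (Acc; acc)
open import Level using (Level; 0ℓ)
open import Relation.Binary using (IsDecPartialOrder; tri<; tri≈; tri>)
open import Relation.Binary.PropositionalEquality as ≡ using (_≡_; _≢_; refl; cong; cong₂)
import Relation.Binary.Reasoning.Setoid as SetoidReasoning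
open import Relation.Nullary using (¬_; Dec; yes; no; does)
open import Relation.Nullary.Decidable using (_×-dec_; ¬?; does-⇔; dec-true; dec-false)
open import Relation.Unary using (Pred; Decidable)

length-sublists : {A : Set} (xs : List A) {ys : List A} → ys ∈ sublists xs → length ys ≤ length xs
length-sublists []       (here refl) = ℕ.z≤n
length-sublists (x ∷ xs) ys∈ with ∈-++⁻ (sublists xs) ys∈
... | inj₁ ys∈′ = ℕP.m≤n⇒m≤1+n (length-sublists xs ys∈′)
... | inj₂ ys∈′ with ∈-map⁻ (x ∷_) ys∈′
...   | zs , zs∈ , refl = ℕ.s≤s (length-sublists xs zs∈)

length-filter-< : {A : Set} {p q : Level} {P : Pred A p} {Q : Pred A q} (P? : Decidable P) (Q? : Decidable Q) →
  (∀ {x} → Q x → P x) → ∀ {xs y} → y ∈ xs → P y → ¬ Q y → length (filter Q? xs) < length (filter P? xs)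
length-filter-< P? Q? Q⊆P {x ∷ xs} (here refl) Px ¬Qx with P? x | Q? x
... | no ¬Px | _      = ⊥-elim (¬Px Px)
... | yes _  | yes Qx = ⊥-elim (¬Qx Qx)
... | yes _  | no _   = ℕ.s≤s (length-filter-≤ xs)
  where
  length-filter-≤ : ∀ zs → length (filter Q? zs) ≤ length (filter P? zs)
  length-filter-≤ []       = ℕ.z≤n
  length-filter-≤ (z ∷ zs) with P? z | Q? z
  ... | yes _  | yes _  = ℕ.s≤s (length-filter-≤ zs)
  ... | yes _  | no _   = ℕP.m≤n⇒m≤1+n (length-filter-≤ zs)
  ... | no ¬Pz | yes Qz = ⊥-elim (¬Pz (Q⊆P Qz))
  ... | no _   | no _   = length-filter-≤ zs
length-filter-< P? Q? Q⊆P {x ∷ xs} (there y∈) Py ¬Qy with P? x | Q? x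
... | yes _  | yes _  = ℕ.s≤s (length-filter-< P? Q? Q⊆P y∈ Py ¬Qy)
... | yes _  | no _   = ℕP.m≤n⇒m≤1+n (length-filter-< P? Q? Q⊆P y∈ Py ¬Qy)
... | no ¬Px | yes Qx = ⊥-elim (¬Px (Q⊆P Qx))
... | no _   | no _   = length-filter-< P? Q? Q⊆P y∈ Py ¬Qy

module ListSum {c ℓ} (M : CommutativeMonoid c ℓ) where
  open CommutativeMonoid M renaming (Carrier to C; refl to ≈-refl)
  open CommutativeSemigroupProperties commutativeSemigroup using (interchange)
  open SetoidReasoning setoid

  ∑ : {A : Set} → List A → (A → C) → C
  ∑ xs f = foldr _∙_ ε (map f xs)

  syntax ∑ xs (λ x → e) = ∑[ x ← xs ] e

  when : Bool → C → C
  when b x = if b then x else ε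

  module _ {A : Set} where

    ∑-cong : (xs : List A) {f g : A → C} → (∀ {x} → x ∈ xs → f x ≈ g x) → ∑ xs f ≈ ∑ xs g
    ∑-cong []       f≈g = ≈-refl
    ∑-cong (x ∷ xs) f≈g = ∙-cong (f≈g (here refl)) (∑-cong xs (f≈g ∘ there))

    ∑-zero : (xs : List A) {f : A → C} → (∀ {x} → x ∈ xs → f x ≈ ε) → ∑ xs f ≈ ε
    ∑-zero []       f≈ε = ≈-refl
    ∑-zero (x ∷ xs) f≈ε = trans (∙-cong (f≈ε (here refl)) (∑-zero xs (f≈ε ∘ there))) (identityˡ ε)

    ∑-++ : (xs ys : List A) (f : A → C) → ∑ (xs ++ ys) f ≈ ∑ xs f ∙ ∑ ys f
    ∑-++ []       ys f = sym (identityˡ _)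
    ∑-++ (x ∷ xs) ys f = trans (∙-congˡ (∑-++ xs ys f)) (sym (assoc _ _ _))

    ∑-distrib-∙ : (xs : List A) (f g : A → C) → ∑[ x ← xs ] (f x ∙ g x) ≈ ∑ xs f ∙ ∑ xs g
    ∑-distrib-∙ []       f g = sym (identityˡ ε)
    ∑-distrib-∙ (x ∷ xs) f g = trans (∙-congˡ (∑-distrib-∙ xs f g)) (interchange _ _ _ _)

    ∑-filter : {p : Level} {P : Pred A p} (P? : Decidable P) (xs : List A) (f : A → C) →
               ∑ (filter P? xs) f ≈ ∑[ x ← xs ] when (does (P? x)) (f x)
    ∑-filter P? []       f = ≈-refl
    ∑-filter P? (x ∷ xs) f with does (P? x)
    ... | true  = ∙-congˡ (∑-filter P? xs f)
    ... | false = trans (∑-filter P? xs f) (sym (identityˡ _))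

    ∑-filterᵇ : (p : A → Bool) (xs : List A) (f : A → C) → ∑ (filterᵇ p xs) f ≈ ∑[ x ← xs ] when (p x) (f x)
    ∑-filterᵇ p []       f = ≈-refl
    ∑-filterᵇ p (x ∷ xs) f with p x
    ... | true  = ∙-congˡ (∑-filterᵇ p xs f)
    ... | false = trans (∑-filterᵇ p xs f) (sym (identityˡ _))

    ∑-unique : {xs : List A} {f : A → C} {t : A} → Unique xs → t ∈ xs →
               (∀ {x} → x ∈ xs → x ≢ t → f x ≈ ε) → ∑ xs f ≈ f t
    ∑-unique (x∉xs ∷ _) (here refl) f≈ε =
      trans (∙-congˡ (∑-zero _ λ y∈xs → f≈ε (there y∈xs) (All.lookup x∉xs y∈xs ∘ ≡.sym))) (identityʳ _)
    ∑-unique (x∉xs ∷ u) (there t∈xs) f≈ε =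
      trans (∙-congʳ (f≈ε (here refl) (λ { refl → All.lookup x∉xs t∈xs refl })))
            (trans (identityˡ _) (∑-unique u t∈xs (f≈ε ∘ there)))

  ∑-map : {A B : Set} (g : A → B) (xs : List A) (f : B → C) → ∑ (map g xs) f ≡ ∑ xs (f ∘ g)
  ∑-map g xs f = cong (foldr _∙_ ε) (≡.sym (ListP.map-∘ xs))

  ∑-comm : {A B : Set} (xs : List A) (ys : List B) (f : A → B → C) →
           ∑[ x ← xs ] ∑[ y ← ys ] f x y ≈ ∑[ y ← ys ] ∑[ x ← xs ] f x y
  ∑-comm []       ys f = sym (∑-zero ys λ _ → ≈-refl)
  ∑-comm (x ∷ xs) ys f = begin
    ∑ ys (f x) ∙ ∑[ x′ ← xs ] ∑ ys (f x′)          ≈⟨ ∙-congˡ (∑-comm xs ys f) ⟩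
    ∑ ys (f x) ∙ ∑[ y ← ys ] ∑[ x′ ← xs ] f x′ y   ≈⟨ ∑-distrib-∙ ys (f x) _ ⟨
    ∑[ y ← ys ] (f x y ∙ ∑[ x′ ← xs ] f x′ y)      ∎

  ∑-upTo-suc : (n : ℕ) (f : ℕ → C) → ∑ (upTo (suc n)) f ≈ f 0 ∙ ∑ (upTo n) (f ∘ suc)
  ∑-upTo-suc n f = reflexive (cong (f 0 ∙_) (≡.trans
    (cong (foldr _∙_ ε) (ListP.map-applyUpTo suc f n))
    (cong (foldr _∙_ ε) (≡.sym (ListP.map-upTo (f ∘ suc) n)))))

  ∑-upTo-sucʳ : (n : ℕ) (f : ℕ → C) → ∑ (upTo (suc n)) f ≈ ∑ (upTo n) f ∙ f n
  ∑-upTo-sucʳ n f = trans (reflexive (cong (λ xs → ∑ xs f) (≡.sym (ListP.upTo-∷ʳ n))))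
    (trans (∑-++ (upTo n) (n ∷ []) f) (∙-congˡ (identityʳ (f n))))

  ∑-sublists-∷ : {A : Set} (x : A) (xs : List A) (g : List A → C) →
                 ∑ (sublists (x ∷ xs)) g ≈ ∑ (sublists xs) g ∙ ∑[ S ← sublists xs ] g (x ∷ S)
  ∑-sublists-∷ x xs g = trans (∑-++ (sublists xs) (map (x ∷_) (sublists xs)) g)
                              (∙-congˡ (reflexive (∑-map (x ∷_) (sublists xs) g)))

  module _ {A : Set} {p q : Level} {P : Pred A p} {Q : Pred A q} (P? : Decidable P) (Q? : Decidable Q) where

    ∑-filter-≐ : ∀ xs (f : A → C) → (∀ {x} → x ∈ xs → P x ⇔ Q x) → ∑ (filter P? xs) f ≈ ∑ (filter Q? xs) f
    ∑-filter-≐ [] f P⇔Q = ≈-refl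
    ∑-filter-≐ (x ∷ xs) f P⇔Q with P? x | Q? x | does-⇔ (P⇔Q (here refl)) (P? x) (Q? x)
    ... | yes _ | yes _ | _ = ∙-congˡ (∑-filter-≐ xs f (P⇔Q ∘ there))
    ... | no _  | no _  | _ = ∑-filter-≐ xs f (P⇔Q ∘ there)

    ∑-filter-remove : ∀ {xs t} (f : A → C) → Unique xs → t ∈ xs → P t → ¬ Q t →
      (∀ {x} → Q x → P x) → (∀ {x} → P x → x ≢ t → Q x) → ∑ (filter P? xs) f ≈ ∑ (filter Q? xs) f ∙ f t
    ∑-filter-remove {x ∷ xs} f (x∉ ∷ _) (here refl) Px ¬Qx Q⊆P P⊆Q with P? x | Q? x
    ... | no ¬Px | _    = ⊥-elim (¬Px Px)
    ... | yes _ | yes Qx = ⊥-elim (¬Qx Qx)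
    ... | yes _ | no _  = trans (∙-congˡ (∑-filter-≐ xs f λ y∈ → mk⇔ (λ Py → P⊆Q Py (All.lookup x∉ y∈ ∘ ≡.sym)) Q⊆P))
                                (comm _ _)
    ∑-filter-remove {x ∷ xs} f (x∉ ∷ u) (there t∈) Pt ¬Qt Q⊆P P⊆Q with P? x | Q? x
    ... | yes _  | yes _  = trans (∙-congˡ (∑-filter-remove f u t∈ Pt ¬Qt Q⊆P P⊆Q)) (sym (assoc _ _ _))
    ... | yes Px | no ¬Qx = ⊥-elim (¬Qx (P⊆Q Px λ { refl → All.lookup x∉ t∈ refl }))
    ... | no ¬Px | yes Qx = ⊥-elim (¬Px (Q⊆P Qx))
    ... | no _   | no _   = ∑-filter-remove f u t∈ Pt ¬Qt Q⊆P P⊆Q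

  when-∑ : ∀ {B : Set} b (ys : List B) (g : B → C) → when b (∑ ys g) ≈ ∑[ y ← ys ] when b (g y)
  when-∑ true  ys g = ≈-refl
  when-∑ false ys g = sym (∑-zero ys λ _ → ≈-refl)

  when-when : ∀ b b′ (v : C) → when b (when b′ v) ≈ when (b ∧ b′) v
  when-when true  b′ v = ≈-refl
  when-when false b′ v = ≈-refl

  ∑-filter-nested : {A B : Set} {p q : Level} {P : Pred A p} {Q : A → Pred B q}
    (P? : Decidable P) (Q? : ∀ x → Decidable (Q x)) (xs : List A) (ys : List B) (f : A → B → C) →
    ∑[ x ← filter P? xs ] ∑[ y ← filter (Q? x) ys ] f x y ≈ ∑[ x ← xs ] ∑[ y ← ys ] when (does (P? x ×-dec Q? x y)) (f x y)
  ∑-filter-nested P? Q? xs ys f = begin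
    ∑[ x ← filter P? xs ] ∑[ y ← filter (Q? x) ys ] f x y
      ≈⟨ ∑-filter P? xs _ ⟩
    ∑[ x ← xs ] when (does (P? x)) (∑[ y ← filter (Q? x) ys ] f x y)
      ≈⟨ ∑-cong xs (λ {x} _ → trans (when-cong (does (P? x)) (∑-filter (Q? x) ys (f x))) (when-∑ (does (P? x)) ys _)) ⟩
    ∑[ x ← xs ] ∑[ y ← ys ] when (does (P? x)) (when (does (Q? x y)) (f x y))
      ≈⟨ ∑-cong xs (λ {x} _ → ∑-cong ys λ {y} _ → when-when (does (P? x)) (does (Q? x y)) (f x y)) ⟩
    ∑[ x ← xs ] ∑[ y ← ys ] when (does (P? x ×-dec Q? x y)) (f x y) ∎
    where
    when-cong : ∀ b {u v} → u ≈ v → when b u ≈ when b v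
    when-cong true  u≈v = u≈v
    when-cong false _   = ≈-refl

  ∑-filter-comm : {A B : Set} {p q p′ q′ : Level} {P : Pred A p} {Q : A → Pred B q} {R : Pred B p′} {S : B → Pred A q′}
    (P? : Decidable P) (Q? : ∀ x → Decidable (Q x)) (R? : Decidable R) (S? : ∀ y → Decidable (S y))
    (xs : List A) (ys : List B) (f : A → B → C) → (∀ {x y} → (P x × Q x y) ⇔ (R y × S y x)) →
    ∑[ x ← filter P? xs ] ∑[ y ← filter (Q? x) ys ] f x y ≈ ∑[ y ← filter R? ys ] ∑[ x ← filter (S? y) xs ] f x y
  ∑-filter-comm P? Q? R? S? xs ys f PQ⇔RS = begin
    ∑[ x ← filter P? xs ] ∑[ y ← filter (Q? x) ys ] f x y
      ≈⟨ ∑-filter-nested P? Q? xs ys f ⟩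
    ∑[ x ← xs ] ∑[ y ← ys ] when (does (P? x ×-dec Q? x y)) (f x y)
      ≈⟨ ∑-cong xs (λ {x} _ → ∑-cong ys λ {y} _ →
           reflexive (cong (λ b → when b (f x y)) (does-⇔ PQ⇔RS (P? x ×-dec Q? x y) (R? y ×-dec S? y x)))) ⟩
    ∑[ x ← xs ] ∑[ y ← ys ] when (does (R? y ×-dec S? y x)) (f x y)
      ≈⟨ ∑-comm xs ys _ ⟩
    ∑[ y ← ys ] ∑[ x ← xs ] when (does (R? y ×-dec S? y x)) (f x y)
      ≈⟨ ∑-filter-nested R? S? ys xs (λ y x → f x y) ⟨
    ∑[ y ← filter R? ys ] ∑[ x ← filter (S? y) xs ] f x y ∎

  ∑-filter-fibers : {A B : Set} {q p′ : Level} {Q : Pred A q} {R : B → Pred A p′}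
    (Q? : Decidable Q) (R? : ∀ b → Decidable (R b)) (g : A → B) {bs : List B} → Unique bs →
    (∀ {x} → Q x → g x ∈ bs) → (∀ {b x} → b ∈ bs → R b x ⇔ (Q x × g x ≡ b)) → (xs : List A) (f : A → C) →
    ∑ (filter Q? xs) f ≈ ∑[ b ← bs ] ∑ (filter (R? b) xs) f
  ∑-filter-fibers Q? R? g {bs} bs! Q⇒g∈ R⇔Q xs f = begin
    ∑ (filter Q? xs) f                                  ≈⟨ ∑-filter Q? xs f ⟩
    ∑[ x ← xs ] when (does (Q? x)) (f x)                ≈⟨ ∑-cong xs (λ {x} _ → fiber x) ⟨
    ∑[ x ← xs ] ∑[ b ← bs ] when (does (R? b x)) (f x)  ≈⟨ ∑-comm xs bs _ ⟩
    ∑[ b ← bs ] ∑[ x ← xs ] when (does (R? b x)) (f x)  ≈⟨ ∑-cong bs (λ {b} _ → ∑-filter (R? b) xs f) ⟨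
    ∑[ b ← bs ] ∑ (filter (R? b) xs) f                  ∎
    where
    open Equivalence
    fiber : ∀ x → ∑[ b ← bs ] when (does (R? b x)) (f x) ≈ when (does (Q? x)) (f x)
    fiber x with Q? x
    ... | yes Qx = trans (∑-unique bs! (Q⇒g∈ Qx) λ {b} b∈ b≢gx →
                            reflexive (cong (λ c → when c (f x)) (dec-false (R? b x) λ Rbx → b≢gx (≡.sym (proj₂ (to (R⇔Q b∈) Rbx))))))
                         (reflexive (cong (λ c → when c (f x)) (dec-true (R? (g x) x) (from (R⇔Q (Q⇒g∈ Qx)) (Qx , refl)))))
    ... | no ¬Qx = ∑-zero bs λ {b} b∈ → reflexive (cong (λ c → when c (f x)) (dec-false (R? b x) (¬Qx ∘ proj₁ ∘ to (R⇔Q b∈))))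

module SemiringSum {c ℓ} (R : CommutativeSemiring c ℓ) where
  open CommutativeSemiring R renaming (Carrier to C)
  open ListSum +-commutativeMonoid public

  *-distribˡ-∑ : {A : Set} (a : C) (xs : List A) (f : A → C) → a * ∑ xs f ≈ ∑[ x ← xs ] (a * f x)
  *-distribˡ-∑ a []       f = zeroʳ a
  *-distribˡ-∑ a (x ∷ xs) f = trans (distribˡ a _ _) (+-congˡ (*-distribˡ-∑ a xs f))

  *-distribʳ-∑ : {A : Set} (a : C) (xs : List A) (f : A → C) → ∑ xs f * a ≈ ∑[ x ← xs ] (f x * a)
  *-distribʳ-∑ a xs f = trans (*-comm _ a) (trans (*-distribˡ-∑ a xs f) (∑-cong xs λ _ → *-comm a _))

≡ᵇ-refl : ∀ n → (n ≡ᵇ n) ≡ true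
≡ᵇ-refl zero    = refl
≡ᵇ-refl (suc n) = ≡ᵇ-refl n

≢⇒≡ᵇ-false : ∀ {m n} → m ≢ n → (m ≡ᵇ n) ≡ false
≢⇒≡ᵇ-false {m} {n} m≢n with m ≡ᵇ n in eq
... | true  = ⊥-elim (m≢n (ℕP.≡ᵇ⇒≡ m n (≡.subst Tᵇ (≡.sym eq) tt)))
... | false = refl

≡ᵇ-false⇒≢ : ∀ {m n} → (m ≡ᵇ n) ≡ false → m ≢ n
≡ᵇ-false⇒≢ {m} eq refl = ≡.subst Tᵇ eq (ℕP.≡⇒≡ᵇ m m refl)

∸-split : ∀ {a t r} → a < t → t < r → r ∸ suc a ≡ (t ∸ a) ℕ.+ (r ∸ suc t)
∸-split {a} {t} {r} a<t t<r = ≡.trans (cong (_∸ suc a) (≡.sym (ℕP.m+[n∸m]≡n t<r)))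
                                      (ℕP.+-∸-comm (r ∸ suc t) (ℕ.s≤s (ℕP.<⇒≤ a<t)))

suc[a+i]∸a : ∀ a i → suc (a ℕ.+ i) ∸ a ≡ suc i
suc[a+i]∸a a i = ≡.trans (ℕP.+-∸-assoc 1 (ℕP.m≤m+n a i)) (cong suc (ℕP.m+n∸m≡n a i))

segment : ℕ → ℕ → List ℕ
segment a zero    = []
segment a (suc k) = suc a ∷ segment (suc a) k

⦅_,_⦆ : ℕ → ℕ → List ℕ
⦅ a , b ⦆ = segment a (b ∸ suc a)

∈-segment⁻ : ∀ a k {t} → t ∈ segment a k → a < t × t ≤ a ℕ.+ k
∈-segment⁻ a (suc k) (here refl) = ℕP.≤-refl , ℕP.≤-trans (ℕP.m≤m+n (suc a) k) (ℕP.≤-reflexive (≡.sym (ℕP.+-suc a k)))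
∈-segment⁻ a (suc k) (there t∈) with ∈-segment⁻ (suc a) k t∈
... | a<t , t≤ = ℕP.<-trans (ℕP.n<1+n a) a<t , ℕP.≤-trans t≤ (ℕP.≤-reflexive (≡.sym (ℕP.+-suc a k)))

∈-⦅⦆⁻ : ∀ a b {t} → t ∈ ⦅ a , b ⦆ → a < t × t < b
∈-⦅⦆⁻ a b t∈ with ∈-segment⁻ a (b ∸ suc a) t∈
... | a<t , t≤ = a<t , ℕP.≤-trans (ℕ.s≤s t≤) (ℕP.≤-reflexive (ℕP.m+[n∸m]≡n (ℕP.<⇒≤ a+1<b)))
  where
  a+1<b : suc a < b
  a+1<b = ℕP.m∸n≢0⇒n<m λ k≡0 → ℕP.<-irrefl refl
    (ℕP.<-≤-trans a<t (ℕP.≤-trans t≤ (ℕP.≤-reflexive (≡.trans (cong (a ℕ.+_) k≡0) (ℕP.+-identityʳ a)))))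

∸-pred : ∀ a b {k} → b ∸ suc a ≡ suc k → b ∸ suc (suc a) ≡ k
∸-pred a b eq = ≡.trans (≡.sym (ℕP.pred[m∸n]≡m∸[1+n] b (suc a))) (cong pred eq)

⦅⦆-∷ : ∀ a b {k} → b ∸ suc a ≡ suc k → ⦅ a , b ⦆ ≡ suc a ∷ ⦅ suc a , b ⦆
⦅⦆-∷ a b eq = ≡.trans (cong (segment a) eq) (cong (λ j → suc a ∷ segment (suc a) j) (≡.sym (∸-pred a b eq)))

∸-suc : ∀ {a s} → a < s → s ∸ a ≡ suc (s ∸ suc a)
∸-suc {a} {suc s} (ℕ.s≤s a≤s) = ℕP.+-∸-assoc 1 a≤s

⦅⦆-[] : ∀ a b → b ∸ suc a ≡ 0 → ⦅ a , b ⦆ ≡ []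
⦅⦆-[] a b eq = cong (segment a) eq

∈-segment⁺ : ∀ a k {t} → a < t → t ≤ a ℕ.+ k → t ∈ segment a k
∈-segment⁺ a zero    a<t t≤a+0 = ⊥-elim (ℕP.<-irrefl refl (ℕP.<-≤-trans a<t (ℕP.≤-trans t≤a+0 (ℕP.≤-reflexive (ℕP.+-identityʳ a)))))
∈-segment⁺ a (suc k) {t} a<t t≤ with t ℕ.≟ suc a
... | yes refl = here refl
... | no t≢a+1 = there (∈-segment⁺ (suc a) k (ℕP.≤∧≢⇒< a<t (t≢a+1 ∘ ≡.sym)) (ℕP.≤-trans t≤ (ℕP.≤-reflexive (ℕP.+-suc a k))))

∈-⦅⦆⁺ : ∀ {a b t} → a < t → t < b → t ∈ ⦅ a , b ⦆
∈-⦅⦆⁺ {a} {b} a<t t<b = ∈-segment⁺ a (b ∸ suc a) a<t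
  (ℕP.≤-pred (ℕP.≤-trans t<b (ℕP.≤-reflexive (≡.sym (ℕP.m+[n∸m]≡n (ℕP.<-≤-trans a<t (ℕP.<⇒≤ t<b)))))))

segment-unique : ∀ a k → Unique (segment a k)
segment-unique a zero    = []
segment-unique a (suc k) = All.tabulate (λ t∈ → ℕP.<⇒≢ (proj₁ (∈-segment⁻ (suc a) k t∈))) ∷ segment-unique (suc a) k

∷∈sublists-⦅⦆ : ∀ a b {t T} → (t ∷ T) ∈ sublists ⦅ a , b ⦆ → t ∈ ⦅ a , b ⦆ × T ∈ sublists ⦅ t , b ⦆
∷∈sublists-⦅⦆ a b = go (b ∸ suc a) a refl
  where
  go : ∀ k a {t T} → b ∸ suc a ≡ k → (t ∷ T) ∈ sublists ⦅ a , b ⦆ → t ∈ ⦅ a , b ⦆ × T ∈ sublists ⦅ t , b ⦆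
  go zero    a eq tT∈ rewrite ⦅⦆-[] a b eq with tT∈
  ... | here ()
  ... | there ()
  go (suc k) a eq tT∈ rewrite ⦅⦆-∷ a b eq with ∈-++⁻ (sublists ⦅ suc a , b ⦆) tT∈
  ... | inj₁ tT∈′ = let t∈ , T∈ = go k (suc a) (∸-pred a b eq) tT∈′
                    in there t∈ , T∈
  ... | inj₂ tT∈′ with ∈-map⁻ (suc a ∷_) tT∈′
  ...   | U , U∈ , refl = here refl , U∈

All-<-sublists-⦅⦆ : ∀ a b {T} → T ∈ sublists ⦅ a , b ⦆ → All (a <_) T
All-<-sublists-⦅⦆ a b {[]}    _  = []
All-<-sublists-⦅⦆ a b {t ∷ T} T∈ with t∈ , T∈′ ← ∷∈sublists-⦅⦆ a b T∈ =
  a<t ∷ All.map (ℕP.<-trans a<t) (All-<-sublists-⦅⦆ t b T∈′)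
  where
  a<t : a < t
  a<t = proj₁ (∈-⦅⦆⁻ a b t∈)

map-suc-segment : ∀ a k → map suc (segment a k) ≡ segment (suc a) k
map-suc-segment a zero    = refl
map-suc-segment a (suc k) = cong (suc (suc a) ∷_) (map-suc-segment (suc a) k)

segment-0 : ∀ k → segment 0 k ≡ map suc (upTo k)
segment-0 zero    = refl
segment-0 (suc k) = cong (1 ∷_) (begin
  segment 1 k                      ≡⟨ map-suc-segment 0 k ⟨
  map suc (segment 0 k)            ≡⟨ cong (map suc) (segment-0 k) ⟩
  map suc (map suc (upTo k))       ≡⟨ cong (map suc) (ListP.map-upTo suc k) ⟩
  map suc (applyUpTo suc k)        ∎)
  where
  open ≡.≡-Reasoning

module IntervalSum {c ℓ} (M : CommutativeMonoid c ℓ) where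
  open CommutativeMonoid M renaming (Carrier to C; refl to ≈-refl)
  open ListSum M
  open SetoidReasoning setoid

  ∑-segment : ∀ a k (f : ℕ → C) → ∑ (segment a k) f ≈ ∑[ i ← upTo k ] f (suc (a ℕ.+ i))
  ∑-segment a zero    f = ≈-refl
  ∑-segment a (suc k) f = begin
    f (suc a) ∙ ∑ (segment (suc a) k) f              ≈⟨ ∙-cong (reflexive (cong (f ∘ suc) (≡.sym (ℕP.+-identityʳ a))))
                                                                (trans (∑-segment (suc a) k f)
                                                                       (∑-cong (upTo k) λ {i} _ →
                                                                          reflexive (cong (f ∘ suc) (≡.sym (ℕP.+-suc a i))))) ⟩
    f (suc (a ℕ.+ 0)) ∙ ∑[ i ← upTo k ] f (suc (a ℕ.+ suc i)) ≈⟨ ∑-upTo-suc k (λ i → f (suc (a ℕ.+ i))) ⟨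
    ∑[ i ← upTo (suc k) ] f (suc (a ℕ.+ i))          ∎

  ∑-sublists-⦅⦆ : ∀ a b (g : List ℕ → C) →
    ∑ (sublists ⦅ a , b ⦆) g ≈ g [] ∙ ∑[ t ← ⦅ a , b ⦆ ] ∑[ S ← sublists ⦅ t , b ⦆ ] g (t ∷ S)
  ∑-sublists-⦅⦆ a b g = go (b ∸ suc a) a refl
    where
    go : ∀ k a → b ∸ suc a ≡ k →
         ∑ (sublists ⦅ a , b ⦆) g ≈ g [] ∙ ∑[ t ← ⦅ a , b ⦆ ] ∑[ S ← sublists ⦅ t , b ⦆ ] g (t ∷ S)
    go zero    a eq rewrite ⦅⦆-[] a b eq = ≈-refl
    go (suc k) a eq rewrite ⦅⦆-∷ a b eq = begin
      ∑ (sublists (suc a ∷ ⦅ suc a , b ⦆)) g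
        ≈⟨ ∑-sublists-∷ (suc a) ⦅ suc a , b ⦆ g ⟩
      ∑ (sublists ⦅ suc a , b ⦆) g ∙ head
        ≈⟨ ∙-congʳ (go k (suc a) (∸-pred a b eq)) ⟩
      (g [] ∙ rest) ∙ head
        ≈⟨ assoc (g []) rest head ⟩
      g [] ∙ (rest ∙ head)
        ≈⟨ ∙-congˡ (comm rest head) ⟩
      g [] ∙ (head ∙ rest) ∎
      where
      head : C
      head = ∑[ S ← sublists ⦅ suc a , b ⦆ ] g (suc a ∷ S)
      rest : C
      rest = ∑[ t ← ⦅ suc a , b ⦆ ] ∑[ S ← sublists ⦅ t , b ⦆ ] g (t ∷ S)

  ∑-⦅⦆-triangle : ∀ a b (G : ℕ → ℕ → C) →
    ∑[ t ← ⦅ a , b ⦆ ] ∑[ s ← ⦅ t , b ⦆ ] G t s ≈ ∑[ s ← ⦅ a , b ⦆ ] ∑[ t ← ⦅ a , s ⦆ ] G t s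
  ∑-⦅⦆-triangle a b G = go (b ∸ suc a) a refl
    where
    go : ∀ k a → b ∸ suc a ≡ k →
         ∑[ t ← ⦅ a , b ⦆ ] ∑[ s ← ⦅ t , b ⦆ ] G t s ≈ ∑[ s ← ⦅ a , b ⦆ ] ∑[ t ← ⦅ a , s ⦆ ] G t s
    go zero    a eq rewrite ⦅⦆-[] a b eq = ≈-refl
    go (suc k) a eq rewrite ⦅⦆-∷ a b eq = begin
      ∑[ s ← ⦅ suc a , b ⦆ ] G (suc a) s ∙ ∑[ t ← ⦅ suc a , b ⦆ ] ∑[ s ← ⦅ t , b ⦆ ] G t s
        ≈⟨ ∙-congˡ (go k (suc a) (∸-pred a b eq)) ⟩
      ∑[ s ← ⦅ suc a , b ⦆ ] G (suc a) s ∙ ∑[ s ← ⦅ suc a , b ⦆ ] ∑[ t ← ⦅ suc a , s ⦆ ] G t s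
        ≈⟨ ∑-distrib-∙ ⦅ suc a , b ⦆ (G (suc a)) _ ⟨
      ∑[ s ← ⦅ suc a , b ⦆ ] (G (suc a) s ∙ ∑[ t ← ⦅ suc a , s ⦆ ] G t s)
        ≈⟨ ∑-cong ⦅ suc a , b ⦆ (λ {s} s∈ → reflexive (cong (λ ts → ∑ ts (λ t → G t s))
             (≡.sym (⦅⦆-∷ a s (∸-suc (proj₁ (∈-⦅⦆⁻ (suc a) b s∈))))))) ⟩
      ∑[ s ← ⦅ suc a , b ⦆ ] ∑[ t ← ⦅ a , s ⦆ ] G t s
        ≈⟨ identityˡ _ ⟨
      ε ∙ ∑[ s ← ⦅ suc a , b ⦆ ] ∑[ t ← ⦅ a , s ⦆ ] G t s
        ≈⟨ ∙-congʳ (reflexive (cong (λ ts → ∑ ts (λ t → G t (suc a))) (≡.sym (⦅⦆-[] a (suc a) (ℕP.n∸n≡0 a))))) ⟩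
      ∑[ t ← ⦅ a , suc a ⦆ ] G t (suc a) ∙ ∑[ s ← ⦅ suc a , b ⦆ ] ∑[ t ← ⦅ a , s ⦆ ] G t s ∎


-- Intervals of a graded poset and its incidence algebra

module Intervals (P : GradedBoundedPoset) where
  open GradedBoundedPoset P
  open IsDecPartialOrder isDecPO using (_≟_; _≤?_)
    renaming (refl to ≼-refl; trans to ≼-trans; antisym to ≼-antisym)

  leftOpenInt : Fin n → Fin n → List (Fin n)
  leftOpenInt s t = filter (λ w → (s ≤? w) ×-dec (w ≤? t) ×-dec ¬? (w ≟ s)) (allFin n)

  ∈-closedInt⁻ : ∀ {s t w} → w ∈ closedInt P s t → s ≼ w × w ≼ t
  ∈-closedInt⁻ {s} {t} w∈ = proj₂ (∈-filter⁻ (λ w → (s ≤? w) ×-dec (w ≤? t)) {xs = allFin n} w∈)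

  ∈-halfOpenInt⁻ : ∀ {s t w} → w ∈ halfOpenInt P s t → s ≼ w × w ≼ t × w ≢ t
  ∈-halfOpenInt⁻ {s} {t} w∈ = proj₂ (∈-filter⁻ (λ w → (s ≤? w) ×-dec (w ≤? t) ×-dec ¬? (w ≟ t)) {xs = allFin n} w∈)

  ∈-leftOpenInt⁻ : ∀ {s t w} → w ∈ leftOpenInt s t → s ≼ w × w ≼ t × w ≢ s
  ∈-leftOpenInt⁻ {s} {t} w∈ = proj₂ (∈-filter⁻ (λ w → (s ≤? w) ×-dec (w ≤? t) ×-dec ¬? (w ≟ s)) {xs = allFin n} w∈)

  size : Fin n → Fin n → ℕ
  size s t = length (closedInt P s t)

  size≤n : ∀ s t → size s t ≤ n
  size≤n s t = ℕP.≤-trans (ListP.length-filter (λ w → (s ≤? w) ×-dec (w ≤? t)) (allFin n))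
                          (ℕP.≤-reflexive (ListP.length-tabulate (λ i → i)))

  size-shrinkʳ : ∀ {s t w} → s ≼ w → w ≼ t → w ≢ t → size s w < size s t
  size-shrinkʳ {s} {t} {w} s≼w w≼t w≢t =
    length-filter-< (λ x → (s ≤? x) ×-dec (x ≤? t)) (λ x → (s ≤? x) ×-dec (x ≤? w))
      (λ (s≼x , x≼w) → s≼x , ≼-trans x≼w w≼t) (∈-allFin t) (≼-trans s≼w w≼t , ≼-refl)
      (λ (_ , t≼w) → w≢t (≼-antisym w≼t t≼w))

  size-shrinkˡ : ∀ {s t w} → s ≼ w → w ≼ t → s ≢ w → size w t < size s t
  size-shrinkˡ {s} {t} {w} s≼w w≼t s≢w =
    length-filter-< (λ x → (s ≤? x) ×-dec (x ≤? t)) (λ x → (w ≤? x) ×-dec (x ≤? t))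
      (λ (w≼x , x≼t) → ≼-trans s≼w w≼x , x≼t) (∈-allFin s) (≼-refl , ≼-trans s≼w w≼t)
      (λ (w≼s , _) → s≢w (≼-antisym s≼w w≼s))

  ρ-mono : ∀ {s t} → s ≼ t → s ≢ t → ρ s < ρ t
  ρ-mono {s} {t} = go s t (<-wellFounded (size s t))
    where
    go : ∀ s t → Acc _<_ (size s t) → s ≼ t → s ≢ t → ρ s < ρ t
    go s t (acc rec) s≼t s≢t with any? (λ w → (s ≤? w) ×-dec (w ≤? t) ×-dec ¬? (s ≟ w) ×-dec ¬? (w ≟ t))
    ... | yes (w , s≼w , w≼t , s≢w , w≢t) =
      ℕP.<-trans (go s w (rec (size-shrinkʳ s≼w w≼t w≢t)) s≼w s≢w) (go w t (rec (size-shrinkˡ s≼w w≼t s≢w)) w≼t w≢t)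
    ... | no ∄w = ℕP.≤-reflexive (≡.sym (ρ-cover s t s≼t s≢t covers))
      where
      covers : ∀ w → s ≼ w → w ≼ t → (w ≡ s) ⊎ (w ≡ t)
      covers w s≼w w≼t with w ≟ s | w ≟ t
      ... | yes w≡s | _       = inj₁ w≡s
      ... | no _    | yes w≡t = inj₂ w≡t
      ... | no w≢s  | no w≢t  = ⊥-elim (∄w (w , s≼w , w≼t , w≢s ∘ ≡.sym , w≢t))

  module IntervalSums {c ℓ} (M : CommutativeMonoid c ℓ) where
    open CommutativeMonoid M renaming (Carrier to C; refl to ≈-refl)
    open ListSum M

    ∑-closedInt-top : ∀ {s t} → s ≼ t → (f : Fin n → C) → ∑ (closedInt P s t) f ≈ ∑ (halfOpenInt P s t) f ∙ f t
    ∑-closedInt-top {s} {t} s≼t f = ∑-filter-remove (λ w → (s ≤? w) ×-dec (w ≤? t)) (λ w → (s ≤? w) ×-dec (w ≤? t) ×-dec ¬? (w ≟ t))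
      f (allFin⁺ n) (∈-allFin t) (s≼t , ≼-refl) (λ (_ , _ , t≢t) → t≢t refl)
      (λ (s≼w , w≼t , _) → s≼w , w≼t) (λ (s≼w , w≼t) w≢t → s≼w , w≼t , w≢t)

    ∑-closedInt-bot : ∀ {s t} → s ≼ t → (f : Fin n → C) → ∑ (closedInt P s t) f ≈ ∑ (leftOpenInt s t) f ∙ f s
    ∑-closedInt-bot {s} {t} s≼t f = ∑-filter-remove (λ w → (s ≤? w) ×-dec (w ≤? t)) (λ w → (s ≤? w) ×-dec (w ≤? t) ×-dec ¬? (w ≟ s))
      f (allFin⁺ n) (∈-allFin s) (≼-refl , s≼t) (λ (_ , _ , s≢s) → s≢s refl)
      (λ (s≼w , w≼t , _) → s≼w , w≼t) (λ (s≼w , w≼t) w≢s → s≼w , w≼t , w≢s)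

    ∑-closedInt-refl : ∀ t (f : Fin n → C) → ∑ (closedInt P t t) f ≈ f t
    ∑-closedInt-refl t f = trans (∑-closedInt-top ≼-refl f)
      (trans (∙-congʳ (∑-zero (halfOpenInt P t t) λ w∈ → let t≼w , w≼t , w≢t = ∈-halfOpenInt⁻ w∈ in ⊥-elim (w≢t (≼-antisym w≼t t≼w))))
             (identityˡ (f t)))

    ∑-closedInt-swap : ∀ s t (F : Fin n → Fin n → C) →
      ∑[ w ← closedInt P s t ] ∑[ v ← closedInt P s w ] F v w ≈ ∑[ v ← closedInt P s t ] ∑[ w ← closedInt P v t ] F v w
    ∑-closedInt-swap s t F = ∑-filter-comm
      (λ w → (s ≤? w) ×-dec (w ≤? t)) (λ w v → (s ≤? v) ×-dec (v ≤? w))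
      (λ v → (s ≤? v) ×-dec (v ≤? t)) (λ v w → (v ≤? w) ×-dec (w ≤? t))
      (allFin n) (allFin n) (λ w v → F v w)
      (mk⇔ (λ ((s≼w , w≼t) , (s≼v , v≼w)) → (s≼v , ≼-trans v≼w w≼t) , (v≼w , w≼t))
           (λ ((s≼v , v≼t) , (v≼w , w≼t)) → (≼-trans s≼v v≼w , w≼t) , (s≼v , v≼w)))

module Convolution (P : GradedBoundedPoset) {c ℓ} (R : CommutativeRing c ℓ) where
  open GradedBoundedPoset P
  open IsDecPartialOrder isDecPO using (_≟_) renaming (refl to ≼-refl)
  open Intervals P
  open CommutativeRing R renaming (Carrier to C; refl to ≈-refl)
  open SemiringSum commutativeSemiring
  open IntervalSums +-commutativeMonoid
  open RingProperties ring using (-‿distribˡ-*; -‿distribʳ-*; -‿involutive)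
  open GroupProperties +-group using (∙-cancelˡ)
  open SetoidReasoning setoid

  infixl 7 _⊛_

  _⊛_ : (a b : Fin n → Fin n → C) → Fin n → Fin n → C
  (a ⊛ b) s t = ∑[ w ← closedInt P s t ] (a s w * b w t)

  δ : Fin n → Fin n → C
  δ s t = if does (s ≟ t) then 1# else 0#

  ζ : Fin n → Fin n → C
  ζ _ _ = 1#

  δ-refl : ∀ t → δ t t ≈ 1#
  δ-refl t with t ≟ t
  ... | yes _ = ≈-refl
  ... | no t≢t = ⊥-elim (t≢t refl)

  δ-≢ : ∀ {s t} → s ≢ t → δ s t ≈ 0#
  δ-≢ {s} {t} s≢t with s ≟ t
  ... | yes s≡t = ⊥-elim (s≢t s≡t)
  ... | no _    = ≈-refl

  ⊛-assoc : ∀ a b c s t → ((a ⊛ b) ⊛ c) s t ≈ (a ⊛ (b ⊛ c)) s t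
  ⊛-assoc a b c s t = begin
    ∑[ w ← closedInt P s t ] ((∑[ v ← closedInt P s w ] (a s v * b v w)) * c w t)
      ≈⟨ ∑-cong (closedInt P s t) (λ {w} _ → *-distribʳ-∑ (c w t) (closedInt P s w) _) ⟩
    ∑[ w ← closedInt P s t ] ∑[ v ← closedInt P s w ] (a s v * b v w * c w t)
      ≈⟨ ∑-closedInt-swap s t (λ v w → a s v * b v w * c w t) ⟩
    ∑[ v ← closedInt P s t ] ∑[ w ← closedInt P v t ] (a s v * b v w * c w t)
      ≈⟨ ∑-cong (closedInt P s t) (λ {v} _ → trans (∑-cong (closedInt P v t) λ {w} _ → *-assoc (a s v) (b v w) (c w t))
                                                    (sym (*-distribˡ-∑ (a s v) (closedInt P v t) _))) ⟩
    ∑[ v ← closedInt P s t ] (a s v * (∑[ w ← closedInt P v t ] (b v w * c w t))) ∎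

  ⊛-identityʳ : ∀ a {s t} → s ≼ t → (a ⊛ δ) s t ≈ a s t
  ⊛-identityʳ a {s} {t} s≼t = begin
    (a ⊛ δ) s t
      ≈⟨ ∑-closedInt-top s≼t (λ w → a s w * δ w t) ⟩
    ∑[ w ← halfOpenInt P s t ] (a s w * δ w t) + a s t * δ t t
      ≈⟨ +-cong (∑-zero (halfOpenInt P s t) λ w∈ → trans (*-congˡ (δ-≢ (proj₂ (proj₂ (∈-halfOpenInt⁻ w∈))))) (zeroʳ _))
                (trans (*-congˡ (δ-refl t)) (*-identityʳ (a s t))) ⟩
    0# + a s t
      ≈⟨ +-identityˡ (a s t) ⟩
    a s t ∎

  ⊛-identityˡ : ∀ a {s t} → s ≼ t → (δ ⊛ a) s t ≈ a s t
  ⊛-identityˡ a {s} {t} s≼t = begin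
    (δ ⊛ a) s t
      ≈⟨ ∑-closedInt-bot s≼t (λ w → δ s w * a w t) ⟩
    ∑[ w ← leftOpenInt s t ] (δ s w * a w t) + δ s s * a s t
      ≈⟨ +-cong (∑-zero (leftOpenInt s t) λ w∈ → trans (*-congʳ (δ-≢ (proj₂ (proj₂ (∈-leftOpenInt⁻ w∈)) ∘ ≡.sym))) (zeroˡ _))
                (trans (*-congʳ (δ-refl s)) (*-identityˡ (a s t))) ⟩
    0# + a s t
      ≈⟨ +-identityˡ (a s t) ⟩
    a s t ∎

  neg-⊛-neg : ∀ a b s t → ((λ s t → - a s t) ⊛ (λ s t → - b s t)) s t ≈ (a ⊛ b) s t
  neg-⊛-neg a b s t = ∑-cong (closedInt P s t) λ {w} _ → begin
    - a s w * - b w t       ≈⟨ -‿distribˡ-* (a s w) (- b w t) ⟨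
    - (a s w * - b w t)     ≈⟨ -‿cong (-‿distribʳ-* (a s w) (b w t)) ⟨
    - - (a s w * b w t)     ≈⟨ -‿involutive _ ⟩
    a s w * b w t ∎

  ⊛-inverseʳ : ∀ a b (u : Fin n → C) → (∀ t → u t * a t t ≈ 1#) →
    (∀ {s t} → s ≼ t → (b ⊛ a) s t ≈ δ s t) → ∀ {s t} → s ≼ t → (a ⊛ b) s t ≈ δ s t
  ⊛-inverseʳ a b u u-inv ba≈δ {s} {t} = go s t (<-wellFounded (size s t))
    where
    go : ∀ s t → Acc _<_ (size s t) → s ≼ t → (a ⊛ b) s t ≈ δ s t
    go s t (acc rec) s≼t with s ≟ t
    ... | yes refl = begin
      (a ⊛ b) s s       ≈⟨ ∑-closedInt-refl s (λ w → a s w * b w s) ⟩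
      a s s * b s s     ≈⟨ *-comm (a s s) (b s s) ⟩
      b s s * a s s     ≈⟨ ∑-closedInt-refl s (λ w → b s w * a w s) ⟨
      (b ⊛ a) s s       ≈⟨ ba≈δ ≼-refl ⟩
      δ s s             ≈⟨ δ-refl s ⟩
      1# ∎
    ... | no s≢t = X≈0
      where
      X : C
      X = (a ⊛ b) s t
      lower : ∑[ w ← halfOpenInt P s t ] ((a ⊛ b) s w * a w t) ≈ a s t
      lower = begin
        ∑[ w ← halfOpenInt P s t ] ((a ⊛ b) s w * a w t)
          ≈⟨ ∑-cong (halfOpenInt P s t) (λ w∈ → let s≼w , w≼t , w≢t = ∈-halfOpenInt⁻ w∈ in
               *-congʳ (go s _ (rec (size-shrinkʳ s≼w w≼t w≢t)) s≼w)) ⟩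
        ∑[ w ← halfOpenInt P s t ] (δ s w * a w t)
          ≈⟨ +-identityʳ _ ⟨
        ∑[ w ← halfOpenInt P s t ] (δ s w * a w t) + 0#
          ≈⟨ +-congˡ (trans (*-congʳ (δ-≢ s≢t)) (zeroˡ (a t t))) ⟨
        ∑[ w ← halfOpenInt P s t ] (δ s w * a w t) + δ s t * a t t
          ≈⟨ ∑-closedInt-top s≼t (λ w → δ s w * a w t) ⟨
        (δ ⊛ a) s t
          ≈⟨ ⊛-identityˡ a s≼t ⟩
        a s t ∎
      Xa≈0 : X * a t t ≈ 0#
      Xa≈0 = ∙-cancelˡ (a s t) (X * a t t) 0# (begin
        a s t + X * a t t
          ≈⟨ +-congʳ lower ⟨
        ∑[ w ← halfOpenInt P s t ] ((a ⊛ b) s w * a w t) + X * a t t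
          ≈⟨ ∑-closedInt-top s≼t (λ w → (a ⊛ b) s w * a w t) ⟨
        ((a ⊛ b) ⊛ a) s t
          ≈⟨ ⊛-assoc a b a s t ⟩
        (a ⊛ (b ⊛ a)) s t
          ≈⟨ ∑-cong (closedInt P s t) (λ w∈ → *-congˡ (ba≈δ (proj₂ (∈-closedInt⁻ w∈)))) ⟩
        (a ⊛ δ) s t
          ≈⟨ ⊛-identityʳ a s≼t ⟩
        a s t
          ≈⟨ +-identityʳ (a s t) ⟨
        a s t + 0# ∎)
      X≈0 : X ≈ 0#
      X≈0 = begin
        X                       ≈⟨ *-identityʳ X ⟨
        X * 1#                  ≈⟨ *-congˡ (trans (*-comm (a t t) (u t)) (u-inv t)) ⟨
        X * (a t t * u t)       ≈⟨ *-assoc X (a t t) (u t) ⟨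
        X * a t t * u t         ≈⟨ *-congʳ Xa≈0 ⟩
        0# * u t                ≈⟨ zeroˡ (u t) ⟩
        0# ∎

-- Opened only here: the modules above use the ring operations of their parameters.
open import Data.Integer using (_+_; _*_; -_; _-_; _^_)

-- The polynomial ring ℤ[x]

module ℤ∑ = SemiringSum ℤP.+-*-commutativeSemiring

neg-∑ : {A : Set} (xs : List A) (f : A → ℤ) → - ℤ∑.∑ xs f ≡ ℤ∑.∑[ x ← xs ] (- f x)
neg-∑ []       f = refl
neg-∑ (x ∷ xs) f = ≡.trans (ℤP.neg-distrib-+ (f x) _) (cong (_+_ (- f x)) (neg-∑ xs f))

∑-upTo-reverse : (k : ℕ) (f : ℕ → ℤ) → ℤ∑.∑ (upTo (suc k)) f ≡ ℤ∑.∑[ j ← upTo (suc k) ] f (k ∸ j)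
∑-upTo-reverse zero    f = refl
∑-upTo-reverse (suc k) f = begin
  ℤ∑.∑ (upTo (suc (suc k))) f                          ≡⟨ ℤ∑.∑-upTo-suc (suc k) f ⟩
  f 0 + ℤ∑.∑ (upTo (suc k)) (f ∘ suc)                  ≡⟨ cong (_+_ (f 0)) (∑-upTo-reverse k (f ∘ suc)) ⟩
  f 0 + ℤ∑.∑[ j ← upTo (suc k) ] f (suc (k ∸ j))       ≡⟨ cong (_+_ (f 0)) (ℤ∑.∑-cong (upTo (suc k)) {λ j → f (suc k ∸ j)} λ j∈ →
                                                          cong f (ℕP.+-∸-assoc 1 (ℕP.≤-pred (∈-upTo⁻ j∈)))) ⟨
  f 0 + ℤ∑.∑[ j ← upTo (suc k) ] f (suc k ∸ j)         ≡⟨ ℤP.+-comm (f 0) _ ⟩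
  ℤ∑.∑[ j ← upTo (suc k) ] f (suc k ∸ j) + f 0         ≡⟨ cong (λ i → ℤ∑.∑[ j ← upTo (suc k) ] f (suc k ∸ j) + f i) (ℕP.n∸n≡0 (suc k)) ⟨
  ℤ∑.∑[ j ← upTo (suc k) ] f (suc k ∸ j) + f (suc k ∸ suc k) ≡⟨ ℤ∑.∑-upTo-sucʳ (suc k) (λ j → f (suc k ∸ j)) ⟨
  ℤ∑.∑[ j ← upTo (suc (suc k)) ] f (suc k ∸ j)         ∎
  where open ≡.≡-Reasoning

1P : Poly
1P = constP (+ 1)

tailP : Poly → Poly
tailP p k = p (suc k)

_·P_ : ℤ → Poly → Poly
(a ·P p) k = a * p k

+P-congˡ : (p : Poly) {q q′ : Poly} → q ≈P q′ → (p +P q) ≈P (p +P q′)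
+P-congˡ p q≈q′ k = cong (_+_ (p k)) (q≈q′ k)

+P-congʳ : (q : Poly) {p p′ : Poly} → p ≈P p′ → (p +P q) ≈P (p′ +P q)
+P-congʳ q p≈p′ k = cong (_+ q k) (p≈p′ k)

+P-cong : {p p′ q q′ : Poly} → p ≈P p′ → q ≈P q′ → (p +P q) ≈P (p′ +P q′)
+P-cong p≈p′ q≈q′ k = cong₂ _+_ (p≈p′ k) (q≈q′ k)

*P-cong : {p p′ q q′ : Poly} → p ≈P p′ → q ≈P q′ → (p *P q) ≈P (p′ *P q′)
*P-cong {p} {p′} {q} {q′} p≈p′ q≈q′ k = ℤ∑.∑-cong (upTo (suc k)) {λ j → p j * q (k ∸ j)} λ {j} _ → cong₂ _*_ (p≈p′ j) (q≈q′ (k ∸ j))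

*P-congˡ : (p : Poly) {q q′ : Poly} → q ≈P q′ → (p *P q) ≈P (p *P q′)
*P-congˡ p = *P-cong {p} {p} (λ _ → refl)

*P-congʳ : (q : Poly) {p p′ : Poly} → p ≈P p′ → (p *P q) ≈P (p′ *P q)
*P-congʳ q p≈p′ = *P-cong {q = q} {q} p≈p′ (λ _ → refl)

*P-comm : (p q : Poly) → (p *P q) ≈P (q *P p)
*P-comm p q k = ≡.trans (∑-upTo-reverse k (λ j → p j * q (k ∸ j)))
  (ℤ∑.∑-cong (upTo (suc k)) {λ j → p (k ∸ j) * q (k ∸ (k ∸ j))} λ {j} j∈ →
  ≡.trans (cong (λ i → p (k ∸ j) * q i) (ℕP.m∸[m∸n]≡n (ℕP.≤-pred (∈-upTo⁻ j∈))))
          (ℤP.*-comm (p (k ∸ j)) (q j)))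

*P-distribʳ : (p q r : Poly) → ((q +P r) *P p) ≈P ((q *P p) +P (r *P p))
*P-distribʳ p q r k = ≡.trans (ℤ∑.∑-cong (upTo (suc k)) {λ j → (q j + r j) * p (k ∸ j)} λ {j} _ → ℤP.*-distribʳ-+ (p (k ∸ j)) (q j) (r j))
                              (ℤ∑.∑-distrib-∙ (upTo (suc k)) (λ j → q j * p (k ∸ j)) (λ j → r j * p (k ∸ j)))

*P-suc : (p q : Poly) (k : ℕ) → (p *P q) (suc k) ≡ p 0 * q (suc k) + (tailP p *P q) k
*P-suc p q k = ℤ∑.∑-upTo-suc (suc k) (λ j → p j * q (suc k ∸ j))

·P-*P : (a : ℤ) (p q : Poly) → ((a ·P p) *P q) ≈P (a ·P (p *P q))
·P-*P a p q k = ≡.trans (ℤ∑.∑-cong (upTo (suc k)) {λ j → a * p j * q (k ∸ j)} λ {j} _ → ℤP.*-assoc a (p j) (q (k ∸ j)))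
                       (≡.sym (ℤ∑.*-distribˡ-∑ a (upTo (suc k)) (λ j → p j * q (k ∸ j))))

constP-*P : (a : ℤ) (p : Poly) → (constP a *P p) ≈P (a ·P p)
constP-*P a p zero    = ℤP.+-identityʳ _
constP-*P a p (suc k) = ≡.trans (*P-suc (constP a) p k)
  (≡.trans (cong (_+_ (a * p (suc k))) (ℤ∑.∑-zero (upTo (suc k)) {λ j → constP a (suc j) * p (k ∸ j)} λ {j} _ → ℤP.*-zeroˡ (p (k ∸ j))))
           (ℤP.+-identityʳ _))

*P-assoc : (p q r : Poly) → ((p *P q) *P r) ≈P (p *P (q *P r))
*P-assoc p q r zero    = assoc₀ (p 0) (q 0) (r 0)
  where
  assoc₀ : ∀ a b c → (a * b + + 0) * c + + 0 ≡ a * (b * c + + 0) + + 0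
  assoc₀ = solve-∀
*P-assoc p q r (suc k) = begin
  ((p *P q) *P r) (suc k)
    ≡⟨ *P-suc (p *P q) r k ⟩
  (p *P q) 0 * r (suc k) + (tailP (p *P q) *P r) k
    ≡⟨ cong₂ (λ a b → a * r (suc k) + b) (ℤP.+-identityʳ (p 0 * q 0)) (*P-cong {q = r} tailP-*P (λ _ → refl) k) ⟩
  p 0 * q 0 * r (suc k) + (((p 0 ·P tailP q) +P (tailP p *P q)) *P r) k
    ≡⟨ cong (_+_ (p 0 * q 0 * r (suc k))) (*P-distribʳ r (p 0 ·P tailP q) (tailP p *P q) k) ⟩
  p 0 * q 0 * r (suc k) + (((p 0 ·P tailP q) *P r) k + ((tailP p *P q) *P r) k)
    ≡⟨ cong₂ (λ a b → p 0 * q 0 * r (suc k) + (a + b)) (·P-*P (p 0) (tailP q) r k) (*P-assoc (tailP p) q r k) ⟩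
  p 0 * q 0 * r (suc k) + (p 0 * (tailP q *P r) k + (tailP p *P (q *P r)) k)
    ≡⟨ regroup (p 0) (q 0) (r (suc k)) ((tailP q *P r) k) ((tailP p *P (q *P r)) k) ⟩
  p 0 * (q 0 * r (suc k) + (tailP q *P r) k) + (tailP p *P (q *P r)) k
    ≡⟨ cong (λ a → p 0 * a + (tailP p *P (q *P r)) k) (*P-suc q r k) ⟨
  p 0 * (q *P r) (suc k) + (tailP p *P (q *P r)) k
    ≡⟨ *P-suc p (q *P r) k ⟨
  (p *P (q *P r)) (suc k) ∎
  where
  open ≡.≡-Reasoning
  tailP-*P : tailP (p *P q) ≈P ((p 0 ·P tailP q) +P (tailP p *P q))
  tailP-*P = *P-suc p q
  regroup : ∀ a b c d e → a * b * c + (a * d + e) ≡ a * (b * c + d) + e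
  regroup = solve-∀

ℤ[x]-commutativeRing : CommutativeRing 0ℓ 0ℓ
ℤ[x]-commutativeRing = record
  { Carrier = Poly
  ; _≈_ = _≈P_
  ; _+_ = _+P_
  ; _*_ = _*P_
  ; -_ = negP
  ; 0# = 0P
  ; 1# = 1P
  ; isCommutativeRing = record
    { isRing = record
      { +-isAbelianGroup = Pointwise.isAbelianGroup ℤP.+-0-isAbelianGroup
      ; *-cong = *P-cong
      ; *-assoc = *P-assoc
      ; *-identity = identityˡ , λ p k → ≡.trans (*P-comm p 1P k) (identityˡ p k)
      ; distrib = distribˡ , *P-distribʳ
      }
    ; *-comm = *P-comm
    }
  }
  where
  identityˡ : (p : Poly) → (1P *P p) ≈P p
  identityˡ p k = ≡.trans (constP-*P (+ 1) p k) (ℤP.*-identityˡ (p k))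
  distribˡ : (p q r : Poly) → (p *P (q +P r)) ≈P ((p *P q) +P (p *P r))
  distribˡ p q r k = ≡.trans (*P-comm p (q +P r) k)
    (≡.trans (*P-distribʳ p q r k) (cong₂ _+_ (*P-comm q p k) (*P-comm r p k)))

module ℤ[x] = CommutativeRing ℤ[x]-commutativeRing
module ℤ[x]∑ = SemiringSum ℤ[x].commutativeSemiring
module ℤ[x]-Reasoning = SetoidReasoning ℤ[x].setoid

xP^-*P-< : ∀ i (p : Poly) {k} → k ℕ.< i → (xP^ i *P p) k ≡ + 0
xP^-*P-< (suc i) p {zero}  _   = ℤP.+-identityʳ (+ 0 * p 0)
xP^-*P-< (suc i) p {suc k} k<i = ≡.trans (*P-suc (xP^ (suc i)) p k)
  (≡.trans (cong (_+ (xP^ i *P p) k) (ℤP.*-zeroˡ (p (suc k))))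
           (≡.trans (ℤP.+-identityˡ _) (xP^-*P-< i p (ℕP.≤-pred k<i))))

xP^-*P-+ : ∀ i (p : Poly) k → (xP^ i *P p) (i ℕ.+ k) ≡ p k
xP^-*P-+ zero    p k = ≡.trans (*P-cong {q = p} x⁰≈1 (λ _ → refl) k) (ℤ[x].*-identityˡ p k)
  where
  x⁰≈1 : xP^ 0 ≈P 1P
  x⁰≈1 zero    = refl
  x⁰≈1 (suc _) = refl
xP^-*P-+ (suc i) p k = ≡.trans (*P-suc (xP^ (suc i)) p (i ℕ.+ k))
  (≡.trans (cong (_+ (xP^ i *P p) (i ℕ.+ k)) (ℤP.*-zeroˡ (p (suc (i ℕ.+ k)))))
           (≡.trans (ℤP.+-identityˡ _) (xP^-*P-+ i p k)))

^P-distribˡ-+-*P : (p : Poly) (i j : ℕ) → (p ^P (i ℕ.+ j)) ≈P ((p ^P i) *P (p ^P j))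
^P-distribˡ-+-*P p zero    j = ℤ[x].sym (ℤ[x].*-identityˡ (p ^P j))
^P-distribˡ-+-*P p (suc i) j = ℤ[x].trans (*P-congˡ p (^P-distribˡ-+-*P p i j)) (ℤ[x].sym (ℤ[x].*-assoc p (p ^P i) (p ^P j)))

onePlusX^P-constant : ∀ m → (onePlusX ^P m) 0 ≡ + 1
onePlusX^P-constant zero    = refl
onePlusX^P-constant (suc m) = ≡.trans (ℤP.+-identityʳ _)
  (≡.trans (ℤP.*-identityˡ _) (onePlusX^P-constant m))

∑-coeff : {A : Set} (xs : List A) (F : A → Poly) (k : ℕ) → ℤ[x]∑.∑ xs F k ≡ ℤ∑.∑[ x ← xs ] F x k
∑-coeff []       F k = refl
∑-coeff (x ∷ xs) F k = cong (_+_ (F x k)) (∑-coeff xs F k)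

constP-+ : (a b : ℤ) → constP (a + b) ≈P (constP a +P constP b)
constP-+ a b zero    = refl
constP-+ a b (suc _) = refl

constP-0 : constP (+ 0) ≈P 0P
constP-0 zero    = refl
constP-0 (suc _) = refl

constP-∑ : {X : Set} (xs : List X) (f : X → ℤ) → constP (ℤ∑.∑ xs f) ≈P (ℤ[x]∑.∑[ x ← xs ] constP (f x))
constP-∑ []       f = λ { zero → refl ; (suc _) → refl }
constP-∑ (x ∷ xs) f = ℤ[x].trans (constP-+ (f x) (ℤ∑.∑ xs f)) (+P-congˡ (constP (f x)) (constP-∑ xs f))

negP-∑ : {A : Set} (xs : List A) (F : A → Poly) → (ℤ[x]∑.∑[ x ← xs ] negP (F x)) ≈P negP (ℤ[x]∑.∑ xs F)
negP-∑ xs F k = ≡.trans (∑-coeff xs (λ x → negP (F x)) k) (≡.trans (≡.sym (neg-∑ xs (λ x → F x k))) (cong -_ (≡.sym (∑-coeff xs F k))))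

xP^-suc : ∀ i → xP^ (suc i) ≈P (xP^ 1 *P xP^ i)
xP^-suc i zero    = ≡.sym (xP^-*P-< 1 (xP^ i) (ℕ.s≤s ℕ.z≤n))
xP^-suc i (suc k) = ≡.sym (xP^-*P-+ 1 (xP^ i) k)

-- A chain whose ranks are a₀ < a₁ < ⋯ < a_k < r contributes fGap(a₁ − a₀) ⋯ fGap(a_k − a_{k−1}) fTail(r − a_k)
-- to H; hGap and hTail are the corresponding factors in the expansion over β.
fGap : ℕ → Poly
fGap d zero    = + 0
fGap d (suc k) = if suc k <ᵇ d then + 1 else + 0

fTail : ℕ → Poly
fTail d = 1P +P fGap d

hGap : ℕ → Poly
hGap (suc (suc d)) = xP^ 1 *P (onePlusX ^P d)
hGap _             = 0P

hTail : ℕ → Poly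
hTail d = onePlusX ^P (d ∸ 1)

module _ where
  open ℤ[x]∑ using (∑; ∑-cong; ∑-distrib-∙; ∑-upTo-sucʳ; *-distribˡ-∑)
  open IntervalSum ℤ[x].+-commutativeMonoid using (∑-segment)
  open CommutativeSemigroupProperties ℤ[x].+-commutativeSemigroup using (interchange)
  open CommutativeSemigroupProperties ℤ[x].*-commutativeSemigroup using (x∙yz≈y∙xz)
  open ℤ[x]-Reasoning

  fGap-suc : ∀ d → 1 ℕ.≤ d → fGap (suc d) ≈P (xP^ 1 *P fTail d)
  fGap-suc d       _ zero          = ≡.sym (xP^-*P-< 1 (fTail d) (ℕ.s≤s ℕ.z≤n))
  fGap-suc (suc d) _ (suc zero)    = ≡.sym (xP^-*P-+ 1 (fTail (suc d)) 0)
  fGap-suc d       _ (suc (suc k)) = ≡.trans (≡.sym (ℤP.+-identityˡ _)) (≡.sym (xP^-*P-+ 1 (fTail d) (suc k)))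

  hTail-telescope : ∀ e → (1P +P (∑[ i ← upTo e ] hGap (suc i))) ≈P hTail e
  hTail-telescope zero          = λ { zero → refl ; (suc _) → refl }
  hTail-telescope (suc zero)    = λ { zero → refl ; (suc _) → refl }
  hTail-telescope (suc (suc e)) = begin
    1P +P (∑[ i ← upTo (suc (suc e)) ] hGap (suc i))         ≈⟨ +P-congˡ 1P (∑-upTo-sucʳ (suc e) (λ i → hGap (suc i))) ⟩
    1P +P ((∑[ i ← upTo (suc e) ] hGap (suc i)) +P hGap (suc (suc e)))
                                                              ≈⟨ ℤ[x].+-assoc 1P (∑[ i ← upTo (suc e) ] hGap (suc i)) (hGap (suc (suc e))) ⟨
    (1P +P (∑[ i ← upTo (suc e) ] hGap (suc i))) +P hGap (suc (suc e))
                                                              ≈⟨ +P-congʳ (hGap (suc (suc e))) (hTail-telescope (suc e)) ⟩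
    hTail (suc e) +P (xP^ 1 *P hTail (suc e))                 ≈⟨ +P-congʳ (xP^ 1 *P hTail (suc e)) (ℤ[x].*-identityˡ (hTail (suc e))) ⟨
    (1P *P hTail (suc e)) +P (xP^ 1 *P hTail (suc e))         ≈⟨ ℤ[x].distribʳ (hTail (suc e)) 1P (xP^ 1) ⟨
    onePlusX *P hTail (suc e)                                 ∎

  hGap-split  : ∀ e → hGap (suc e) ≈P (fGap (suc e) +P (∑[ i ← upTo e ] (hGap (suc i) *P fGap (e ∸ i))))
  hTail-split : ∀ e → hTail (suc e) ≈P (fTail (suc e) +P (∑[ i ← upTo e ] (hGap (suc i) *P fTail (e ∸ i))))

  hGap-split zero    = λ { zero → refl ; (suc _) → refl }
  hGap-split (suc e) = ℤ[x].sym (begin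
    fGap (suc (suc e)) +P (∑[ i ← upTo (suc e) ] (hGap (suc i) *P fGap (suc e ∸ i)))
      ≈⟨ +P-congˡ (fGap (suc (suc e))) (∑-upTo-sucʳ e (λ i → hGap (suc i) *P fGap (suc e ∸ i))) ⟩
    fGap (suc (suc e)) +P ((∑[ i ← upTo e ] (hGap (suc i) *P fGap (suc e ∸ i))) +P (hGap (suc e) *P fGap (suc e ∸ e)))
      ≈⟨ +P-cong (fGap-suc (suc e) (ℕ.s≤s ℕ.z≤n)) interior ⟩
    (xP^ 1 *P fTail (suc e)) +P (xP^ 1 *P (∑[ i ← upTo e ] (hGap (suc i) *P fTail (e ∸ i))))
      ≈⟨ ℤ[x].distribˡ (xP^ 1) (fTail (suc e)) (∑[ i ← upTo e ] (hGap (suc i) *P fTail (e ∸ i))) ⟨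
    xP^ 1 *P (fTail (suc e) +P (∑[ i ← upTo e ] (hGap (suc i) *P fTail (e ∸ i))))
      ≈⟨ *P-congˡ (xP^ 1) (hTail-split e) ⟨
    xP^ 1 *P hTail (suc e) ∎)
    where
    fGap-1 : fGap 1 ≈P 0P
    fGap-1 zero    = refl
    fGap-1 (suc _) = refl
    last : (hGap (suc e) *P fGap (suc e ∸ e)) ≈P 0P
    last = ℤ[x].trans (*P-congˡ (hGap (suc e)) (ℤ[x].trans (ℤ[x].reflexive (cong fGap (ℕP.m+n∸n≡m 1 e))) fGap-1))
                      (ℤ[x].zeroʳ (hGap (suc e)))
    term : ∀ {i} → i ∈ upTo e → (hGap (suc i) *P fGap (suc e ∸ i)) ≈P (xP^ 1 *P (hGap (suc i) *P fTail (e ∸ i)))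
    term {i} i∈ = ℤ[x].trans
      (*P-congˡ (hGap (suc i)) (ℤ[x].trans (ℤ[x].reflexive (cong fGap (ℕP.+-∸-assoc 1 (ℕP.<⇒≤ i<e))))
                                           (fGap-suc (e ∸ i) (ℕP.m<n⇒0<n∸m i<e))))
      (x∙yz≈y∙xz (hGap (suc i)) (xP^ 1) (fTail (e ∸ i)))
      where
      i<e : i < e
      i<e = ∈-upTo⁻ i∈
    interior : ((∑[ i ← upTo e ] (hGap (suc i) *P fGap (suc e ∸ i))) +P (hGap (suc e) *P fGap (suc e ∸ e)))
               ≈P (xP^ 1 *P (∑[ i ← upTo e ] (hGap (suc i) *P fTail (e ∸ i))))
    interior = begin
      (∑[ i ← upTo e ] (hGap (suc i) *P fGap (suc e ∸ i))) +P (hGap (suc e) *P fGap (suc e ∸ e))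
        ≈⟨ +P-cong (∑-cong (upTo e) term) last ⟩
      (∑[ i ← upTo e ] (xP^ 1 *P (hGap (suc i) *P fTail (e ∸ i)))) +P 0P
        ≈⟨ ℤ[x].+-identityʳ _ ⟩
      ∑[ i ← upTo e ] (xP^ 1 *P (hGap (suc i) *P fTail (e ∸ i)))
        ≈⟨ *-distribˡ-∑ (xP^ 1) (upTo e) (λ i → hGap (suc i) *P fTail (e ∸ i)) ⟨
      xP^ 1 *P (∑[ i ← upTo e ] (hGap (suc i) *P fTail (e ∸ i))) ∎

  hTail-split e = ℤ[x].sym (begin
    fTail (suc e) +P (∑[ i ← upTo e ] (hGap (suc i) *P fTail (e ∸ i)))
      ≈⟨ +P-congˡ (fTail (suc e)) (∑-cong (upTo e) λ {i} _ → ℤ[x].trans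
           (ℤ[x].distribˡ (hGap (suc i)) 1P (fGap (e ∸ i)))
           (+P-congʳ (hGap (suc i) *P fGap (e ∸ i)) (ℤ[x].*-identityʳ (hGap (suc i))))) ⟩
    fTail (suc e) +P (∑[ i ← upTo e ] (hGap (suc i) +P (hGap (suc i) *P fGap (e ∸ i))))
      ≈⟨ +P-congˡ (fTail (suc e)) (∑-distrib-∙ (upTo e) (λ i → hGap (suc i)) _) ⟩
    (1P +P fGap (suc e)) +P ((∑[ i ← upTo e ] hGap (suc i)) +P (∑[ i ← upTo e ] (hGap (suc i) *P fGap (e ∸ i))))
      ≈⟨ interchange 1P (fGap (suc e)) _ _ ⟩
    (1P +P (∑[ i ← upTo e ] hGap (suc i))) +P (fGap (suc e) +P (∑[ i ← upTo e ] (hGap (suc i) *P fGap (e ∸ i))))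
      ≈⟨ +P-congˡ (1P +P (∑[ i ← upTo e ] hGap (suc i))) (hGap-split e) ⟨
    (1P +P (∑[ i ← upTo e ] hGap (suc i))) +P hGap (suc e)
      ≈⟨ ℤ[x].+-assoc 1P (∑[ i ← upTo e ] hGap (suc i)) (hGap (suc e)) ⟩
    1P +P ((∑[ i ← upTo e ] hGap (suc i)) +P hGap (suc e))
      ≈⟨ +P-congˡ 1P (∑-upTo-sucʳ e (λ i → hGap (suc i))) ⟨
    1P +P (∑[ i ← upTo (suc e) ] hGap (suc i))
      ≈⟨ hTail-telescope (suc e) ⟩
    hTail (suc e) ∎)

  ∑-⦅⦆-hGap : ∀ a s (F : ℕ → Poly) →
    (∑[ t ← ⦅ a , s ⦆ ] (hGap (t ∸ a) *P F (s ∸ t))) ≈P (∑[ i ← upTo (s ∸ suc a) ] (hGap (suc i) *P F (s ∸ suc a ∸ i)))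
  ∑-⦅⦆-hGap a s F = ℤ[x].trans (∑-segment a (s ∸ suc a) (λ t → hGap (t ∸ a) *P F (s ∸ t)))
    (∑-cong (upTo (s ∸ suc a)) λ {i} _ → ℤ[x].reflexive (cong₂ (λ m n → hGap m *P F n)
      (suc[a+i]∸a a i) (≡.sym (ℕP.∸-+-assoc s (suc a) i))))

  hGap-split-⦅⦆ : ∀ {a s} → a < s →
    hGap (s ∸ a) ≈P (fGap (s ∸ a) +P (∑[ t ← ⦅ a , s ⦆ ] (hGap (t ∸ a) *P fGap (s ∸ t))))
  hGap-split-⦅⦆ {a} {s} a<s rewrite ∸-suc a<s =
    ℤ[x].trans (hGap-split (s ∸ suc a)) (+P-congˡ (fGap (suc (s ∸ suc a))) (ℤ[x].sym (∑-⦅⦆-hGap a s fGap)))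

  hTail-split-⦅⦆ : ∀ {a s} → a < s →
    hTail (s ∸ a) ≈P (fTail (s ∸ a) +P (∑[ t ← ⦅ a , s ⦆ ] (hGap (t ∸ a) *P fTail (s ∸ t))))
  hTail-split-⦅⦆ {a} {s} a<s rewrite ∸-suc a<s =
    ℤ[x].trans (hTail-split (s ∸ suc a)) (+P-congˡ (fTail (suc (s ∸ suc a))) (ℤ[x].sym (∑-⦅⦆-hGap a s fTail)))

indicator : Bool → ℤ
indicator b = if b then + 1 else + 0

∑-xP^ : ∀ m N → ℤ∑.∑[ j ← upTo N ] xP^ m j ≡ indicator (m <ᵇ N)
∑-xP^ m N with m <ᵇ N in m<ᵇN
... | true  = ≡.trans (ℤ∑.∑-unique (upTo⁺ N) (∈-upTo⁺ (ℕP.<ᵇ⇒< m N (≡.subst Tᵇ (≡.sym m<ᵇN) tt)))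
                         (λ {j} _ j≢m → cong indicator (≢⇒≡ᵇ-false (j≢m ∘ ≡.sym))))
                      (cong indicator (≡ᵇ-refl m))
... | false = ℤ∑.∑-zero (upTo N) λ {j} j∈ → cong indicator (≢⇒≡ᵇ-false {m} {j} λ { refl → ≡.subst Tᵇ m<ᵇN (ℕP.<⇒<ᵇ (∈-upTo⁻ j∈)) })

<ᵇ-flip : ∀ m n → (m <ᵇ n) ≡ not (n <ᵇ suc m)
<ᵇ-flip zero    zero    = refl
<ᵇ-flip zero    (suc n) = refl
<ᵇ-flip (suc m) zero    = refl
<ᵇ-flip (suc m) (suc n) = <ᵇ-flip m n

divXm1-cong : {p q : Poly} → p ≈P q → divXm1 p ≈P divXm1 q
divXm1-cong {p} p≈q k = cong -_ (ℤ∑.∑-cong (upTo (suc k)) {p} λ {j} _ → p≈q j)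

divXm1-∑ : {A : Set} (xs : List A) (F : A → Poly) → divXm1 (ℤ[x]∑.∑ xs F) ≈P (ℤ[x]∑.∑[ x ← xs ] divXm1 (F x))
divXm1-∑ xs F k = begin
  - (ℤ∑.∑[ j ← upTo (suc k) ] ℤ[x]∑.∑ xs F j)         ≡⟨ cong -_ (ℤ∑.∑-cong (upTo (suc k)) λ {j} _ → ∑-coeff xs F j) ⟩
  - (ℤ∑.∑[ j ← upTo (suc k) ] ℤ∑.∑[ x ← xs ] F x j)   ≡⟨ cong -_ (ℤ∑.∑-comm (upTo (suc k)) xs (λ j x → F x j)) ⟩
  - (ℤ∑.∑[ x ← xs ] ℤ∑.∑[ j ← upTo (suc k) ] F x j)   ≡⟨ neg-∑ xs _ ⟩
  ℤ∑.∑[ x ← xs ] divXm1 (F x) k                        ≡⟨ ∑-coeff xs (λ x → divXm1 (F x)) k ⟨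
  ℤ[x]∑.∑ xs (λ x → divXm1 (F x)) k ∎
  where open ≡.≡-Reasoning

divXm1-xᵈ-1 : ∀ {d} → 1 ≤ d → (divXm1 (xP^ d +P negP (xP^ 0)) +P constP (- + 1)) ≈P fGap d
divXm1-xᵈ-1 {d} 1≤d k = ≡.trans (cong (λ z → - z + constP (- + 1) k) (begin
    ℤ∑.∑[ j ← upTo (suc k) ] (xP^ d j + - xP^ 0 j)
      ≡⟨ ℤ∑.∑-distrib-∙ (upTo (suc k)) (xP^ d) (λ j → - xP^ 0 j) ⟩
    ℤ∑.∑ (upTo (suc k)) (xP^ d) + ℤ∑.∑[ j ← upTo (suc k) ] (- xP^ 0 j)
      ≡⟨ cong₂ _+_ (∑-xP^ d (suc k)) (≡.trans (≡.sym (neg-∑ (upTo (suc k)) (xP^ 0))) (cong -_ (∑-xP^ 0 (suc k)))) ⟩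
    indicator (d <ᵇ suc k) + - + 1 ∎))
  (coefficient 1≤d k)
  where
  open ≡.≡-Reasoning
  coefficient : ∀ {d} → 1 ≤ d → ∀ k → - (indicator (d <ᵇ suc k) + - + 1) + constP (- + 1) k ≡ fGap d k
  coefficient {suc d} _ zero = refl
  coefficient {d}     _ (suc k) rewrite <ᵇ-flip (suc k) d with d <ᵇ suc (suc k)
  ... | true  = refl
  ... | false = refl

-- Flag f- and h-expansions

flagH : (List ℕ → ℤ) → List ℕ → ℤ
flagH A S = ℤ∑.∑[ T ← sublists S ] ((- + 1) ^ (length S ∸ length T) * A T)

flagH-[] : (A : List ℕ → ℤ) → flagH A [] ≡ A []
flagH-[] A = ≡.trans (ℤP.+-identityʳ _) (ℤP.*-identityˡ (A []))

flagH-∷ : (A : List ℕ → ℤ) (t : ℕ) (T : List ℕ) → flagH A (t ∷ T) + flagH A T ≡ flagH (λ S → A (t ∷ S)) T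
flagH-∷ A t T = begin
  flagH A (t ∷ T) + flagH A T
    ≡⟨ cong (_+ flagH A T) (ℤ∑.∑-sublists-∷ t T (λ U → (- + 1) ^ (suc (length T) ∸ length U) * A U)) ⟩
  (ℤ∑.∑ (sublists T) (λ U → (- + 1) ^ (suc (length T) ∸ length U) * A U) + flagH (λ S → A (t ∷ S)) T) + flagH A T
    ≡⟨ cong (λ x → (x + flagH (λ S → A (t ∷ S)) T) + flagH A T) (≡.trans
         (ℤ∑.∑-cong (sublists T) λ {U} U∈ → ≡.trans
            (cong (λ n → (- + 1) ^ n * A U) (ℕP.+-∸-assoc 1 (length-sublists T U∈)))
            (ℤP.*-assoc (- + 1) ((- + 1) ^ (length T ∸ length U)) (A U)))
         (≡.sym (ℤ∑.*-distribˡ-∑ (- + 1) (sublists T) _))) ⟩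
  (- + 1 * flagH A T + flagH (λ S → A (t ∷ S)) T) + flagH A T
    ≡⟨ cancel (flagH A T) (flagH (λ S → A (t ∷ S)) T) ⟩
  flagH (λ S → A (t ∷ S)) T ∎
  where
  open ≡.≡-Reasoning
  cancel : ∀ f g → (- + 1 * f + g) + f ≡ g
  cancel = solve-∀

γTerm : ℕ → ℕ → Poly
γTerm i m = xP^ i *P (onePlusX ^P m)

hGap-*P-γTerm : ∀ m j e → (hGap (suc (suc m)) *P γTerm j e) ≈P γTerm (suc j) (m ℕ.+ e)
hGap-*P-γTerm m j e = ℤ[x].trans (interchange (xP^ 1) (onePlusX ^P m) (xP^ j) (onePlusX ^P e))
  (*P-cong (ℤ[x].sym (xP^-suc j)) (ℤ[x].sym (^P-distribˡ-+-*P onePlusX m e)))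
  where open CommutativeSemigroupProperties ℤ[x].*-commutativeSemigroup using (interchange)

elemℕ-false : ∀ {x S} → All (x <_) S → elemℕ x S ≡ false
elemℕ-false []           = refl
elemℕ-false (x<u ∷ x<S) = cong₂ _∨_ (≢⇒≡ᵇ-false (ℕP.<⇒≢ x<u)) (elemℕ-false x<S)

-- good is noneConsecutive 0, definitionally
noneConsecutive : ℕ → List ℕ → Bool
noneConsecutive a S = not (elemℕ (suc a) S) ∧ all (λ i → not (elemℕ (suc i) S)) S

module Flags (r : ℕ) where
  open ℤ[x]∑ using (∑; ∑-cong; ∑-zero; ∑-unique; ∑-comm; ∑-filterᵇ; ∑-distrib-∙; *-distribˡ-∑; *-distribʳ-∑; when)
  open IntervalSum ℤ[x].+-commutativeMonoid using (∑-sublists-⦅⦆; ∑-⦅⦆-triangle)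
  open CommutativeSemigroupProperties ℤ[x].+-commutativeSemigroup using (interchange)
  open CommutativeSemigroupProperties ℤ[x].*-commutativeSemigroup using (x∙yz≈y∙xz)
  open GroupProperties ℤ[x].+-group using (∙-cancelʳ)

  above : ℕ → List ℕ
  above a = ⦅ a , r ⦆

  weight : (gap tail : ℕ → Poly) → ℕ → List ℕ → Poly
  weight gap tail a []      = tail (r ∸ a)
  weight gap tail a (b ∷ S) = gap (b ∸ a) *P weight gap tail b S

  expansion : (gap tail : ℕ → Poly) → ℕ → (List ℕ → ℤ) → Poly
  expansion gap tail a c = ∑[ S ← sublists (above a) ] (constP (c S) *P weight gap tail a S)

  fExpansion : ℕ → (List ℕ → ℤ) → Poly
  fExpansion = expansion fGap fTail

  hExpansion : ℕ → (List ℕ → ℤ) → Poly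
  hExpansion a A = expansion hGap hTail a (flagH A)

  module _ (gap tail : ℕ → Poly) where

    expansion-∷ : ∀ a c → expansion gap tail a c ≈P
      ((constP (c []) *P tail (r ∸ a)) +P (∑[ b ← above a ] (gap (b ∸ a) *P expansion gap tail b (λ S → c (b ∷ S)))))
    expansion-∷ a c = ℤ[x].trans (∑-sublists-⦅⦆ a r (λ S → constP (c S) *P weight gap tail a S))
      (+P-congˡ (constP (c []) *P tail (r ∸ a)) (∑-cong (above a) λ {b} _ → begin
        ∑[ S ← sublists (above b) ] (constP (c (b ∷ S)) *P (gap (b ∸ a) *P weight gap tail b S))
          ≈⟨ ∑-cong (sublists (above b)) (λ {S} _ → x∙yz≈y∙xz (constP (c (b ∷ S))) (gap (b ∸ a)) _) ⟩
        ∑[ S ← sublists (above b) ] (gap (b ∸ a) *P (constP (c (b ∷ S)) *P weight gap tail b S))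
          ≈⟨ *-distribˡ-∑ (gap (b ∸ a)) (sublists (above b)) _ ⟨
        gap (b ∸ a) *P expansion gap tail b (λ S → c (b ∷ S)) ∎))
      where open ℤ[x]-Reasoning

    expansion-+ : ∀ a c d → (expansion gap tail a c +P expansion gap tail a d) ≈P expansion gap tail a (λ S → c S + d S)
    expansion-+ a c d = ℤ[x].sym (ℤ[x].trans
      (∑-cong (sublists (above a)) λ {S} _ → ℤ[x].trans
        (*P-congʳ (weight gap tail a S) (constP-+ (c S) (d S)))
        (ℤ[x].distribʳ (weight gap tail a S) (constP (c S)) (constP (d S))))
      (∑-distrib-∙ (sublists (above a)) _ _))

    expansion-cong : ∀ a {c d} → (∀ {S} → S ∈ sublists (above a) → c S ≡ d S) → expansion gap tail a c ≈P expansion gap tail a d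
    expansion-cong a c≗d = ∑-cong (sublists (above a)) λ {S} S∈ →
      *P-congʳ (weight gap tail a S) (ℤ[x].reflexive (cong constP (c≗d S∈)))

    expansion-∑ : ∀ a {X : Set} (xs : List X) (c : X → List ℕ → ℤ) →
      expansion gap tail a (λ S → ℤ∑.∑[ x ← xs ] c x S) ≈P (∑[ x ← xs ] expansion gap tail a (c x))
    expansion-∑ a []       c = ∑-zero (sublists (above a)) λ {S} _ →
      ℤ[x].trans (*P-congʳ (weight gap tail a S) constP-0) (ℤ[x].zeroˡ (weight gap tail a S))
    expansion-∑ a (x ∷ xs) c = ℤ[x].trans (ℤ[x].sym (expansion-+ a (c x) (λ S → ℤ∑.∑[ y ← xs ] c y S)))
      (+P-congˡ (expansion gap tail a (c x)) (expansion-∑ a xs c))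

  fExpansion-∷ : ∀ a A → fExpansion a A ≈P
    ((constP (A []) *P fTail (r ∸ a)) +P (∑[ s ← above a ] (fGap (s ∸ a) *P fExpansion s (λ S → A (s ∷ S)))))
  fExpansion-∷ = expansion-∷ fGap fTail

  ∑-hGap-fExpansion : ∀ a A → (∑[ t ← above a ] (hGap (t ∸ a) *P fExpansion t A)) ≈P
    ((constP (A []) *P (∑[ t ← above a ] (hGap (t ∸ a) *P fTail (r ∸ t))))
      +P (∑[ s ← above a ] ((∑[ t ← ⦅ a , s ⦆ ] (hGap (t ∸ a) *P fGap (s ∸ t))) *P fExpansion s (λ S → A (s ∷ S)))))
  ∑-hGap-fExpansion a A = begin
    ∑[ t ← above a ] (hGap (t ∸ a) *P fExpansion t A)
      ≈⟨ ∑-cong (above a) (λ {t} _ → ℤ[x].trans (*P-congˡ (hGap (t ∸ a)) (fExpansion-∷ t A))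
           (ℤ[x].distribˡ (hGap (t ∸ a)) _ _)) ⟩
    ∑[ t ← above a ] ((hGap (t ∸ a) *P (cA *P fTail (r ∸ t))) +P (hGap (t ∸ a) *P (∑[ s ← above t ] (fGap (s ∸ t) *P F s))))
      ≈⟨ ∑-distrib-∙ (above a) _ _ ⟩
    (∑[ t ← above a ] (hGap (t ∸ a) *P (cA *P fTail (r ∸ t)))) +P (∑[ t ← above a ] (hGap (t ∸ a) *P (∑[ s ← above t ] (fGap (s ∸ t) *P F s))))
      ≈⟨ +P-cong
           (ℤ[x].trans (∑-cong (above a) λ {t} _ → x∙yz≈y∙xz (hGap (t ∸ a)) cA (fTail (r ∸ t)))
                       (ℤ[x].sym (*-distribˡ-∑ cA (above a) _)))
           (∑-cong (above a) λ {t} _ → ℤ[x].trans (*-distribˡ-∑ (hGap (t ∸ a)) (above t) _)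
              (∑-cong (above t) λ {s} _ → ℤ[x].sym (ℤ[x].*-assoc (hGap (t ∸ a)) (fGap (s ∸ t)) (F s)))) ⟩
    (cA *P (∑[ t ← above a ] (hGap (t ∸ a) *P fTail (r ∸ t)))) +P (∑[ t ← above a ] ∑[ s ← above t ] ((hGap (t ∸ a) *P fGap (s ∸ t)) *P F s))
      ≈⟨ +P-congˡ (cA *P (∑[ t ← above a ] (hGap (t ∸ a) *P fTail (r ∸ t))))
           (ℤ[x].trans (∑-⦅⦆-triangle a r (λ t s → (hGap (t ∸ a) *P fGap (s ∸ t)) *P F s))
                       (∑-cong (above a) λ {s} _ → ℤ[x].sym (*-distribʳ-∑ (F s) ⦅ a , s ⦆ _))) ⟩
    (cA *P (∑[ t ← above a ] (hGap (t ∸ a) *P fTail (r ∸ t))))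
      +P (∑[ s ← above a ] ((∑[ t ← ⦅ a , s ⦆ ] (hGap (t ∸ a) *P fGap (s ∸ t))) *P F s)) ∎
    where
    open ℤ[x]-Reasoning
    cA : Poly
    cA = constP (A [])
    F : ℕ → Poly
    F s = fExpansion s (λ S → A (s ∷ S))

  fExpansion-hRecursion : ∀ {a} → a < r → ∀ A →
    (fExpansion a A +P (∑[ t ← above a ] (hGap (t ∸ a) *P fExpansion t A))) ≈P
    ((constP (A []) *P hTail (r ∸ a)) +P (∑[ s ← above a ] (hGap (s ∸ a) *P fExpansion s (λ S → A (s ∷ S)))))
  fExpansion-hRecursion {a} a<r A = begin
    fExpansion a A +P (∑[ t ← above a ] (hGap (t ∸ a) *P fExpansion t A))
      ≈⟨ +P-cong (fExpansion-∷ a A) (∑-hGap-fExpansion a A) ⟩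
    ((cA *P fTail (r ∸ a)) +P (∑[ s ← above a ] (fGap (s ∸ a) *P F s)))
      +P ((cA *P tails) +P (∑[ s ← above a ] (gaps s *P F s)))
      ≈⟨ interchange (cA *P fTail (r ∸ a)) _ (cA *P tails) _ ⟩
    ((cA *P fTail (r ∸ a)) +P (cA *P tails))
      +P ((∑[ s ← above a ] (fGap (s ∸ a) *P F s)) +P (∑[ s ← above a ] (gaps s *P F s)))
      ≈⟨ +P-cong (ℤ[x].sym (ℤ[x].distribˡ cA (fTail (r ∸ a)) tails))
                 (ℤ[x].sym (ℤ[x].trans (∑-cong (above a) λ {s} _ → ℤ[x].distribʳ (F s) (fGap (s ∸ a)) (gaps s))
                                       (∑-distrib-∙ (above a) _ _))) ⟩
    (cA *P (fTail (r ∸ a) +P tails)) +P (∑[ s ← above a ] ((fGap (s ∸ a) +P gaps s) *P F s))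
      ≈⟨ +P-cong (*P-congˡ cA (ℤ[x].sym (hTail-split-⦅⦆ a<r)))
                 (∑-cong (above a) λ {s} s∈ → *P-congʳ (F s) (ℤ[x].sym (hGap-split-⦅⦆ (proj₁ (∈-⦅⦆⁻ a r s∈))))) ⟩
    (cA *P hTail (r ∸ a)) +P (∑[ s ← above a ] (hGap (s ∸ a) *P F s)) ∎
    where
    open ℤ[x]-Reasoning
    cA : Poly
    cA = constP (A [])
    tails : Poly
    tails = ∑[ t ← above a ] (hGap (t ∸ a) *P fTail (r ∸ t))
    gaps : ℕ → Poly
    gaps s = ∑[ t ← ⦅ a , s ⦆ ] (hGap (t ∸ a) *P fGap (s ∸ t))
    F : ℕ → Poly
    F s = fExpansion s (λ S → A (s ∷ S))

  hExpansion-hRecursion : ∀ a A →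
    (hExpansion a A +P (∑[ t ← above a ] (hGap (t ∸ a) *P hExpansion t A))) ≈P
    ((constP (A []) *P hTail (r ∸ a)) +P (∑[ s ← above a ] (hGap (s ∸ a) *P hExpansion s (λ S → A (s ∷ S)))))
  hExpansion-hRecursion a A = begin
    hExpansion a A +P (∑[ t ← above a ] (hGap (t ∸ a) *P hExpansion t A))
      ≈⟨ +P-congʳ (∑[ t ← above a ] (hGap (t ∸ a) *P hExpansion t A)) (expansion-∷ hGap hTail a (flagH A)) ⟩
    ((constP (flagH A []) *P hTail (r ∸ a)) +P (∑[ t ← above a ] (hGap (t ∸ a) *P E t (λ T → flagH A (t ∷ T)))))
      +P (∑[ t ← above a ] (hGap (t ∸ a) *P E t (flagH A)))
      ≈⟨ ℤ[x].+-assoc (constP (flagH A []) *P hTail (r ∸ a)) _ _ ⟩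
    (constP (flagH A []) *P hTail (r ∸ a))
      +P ((∑[ t ← above a ] (hGap (t ∸ a) *P E t (λ T → flagH A (t ∷ T)))) +P (∑[ t ← above a ] (hGap (t ∸ a) *P E t (flagH A))))
      ≈⟨ +P-cong (*P-congʳ (hTail (r ∸ a)) (ℤ[x].reflexive (cong constP (flagH-[] A))))
                 (ℤ[x].sym (ℤ[x].trans (∑-cong (above a) λ {t} _ → merge t) (∑-distrib-∙ (above a) _ _))) ⟩
    (constP (A []) *P hTail (r ∸ a)) +P (∑[ s ← above a ] (hGap (s ∸ a) *P hExpansion s (λ S → A (s ∷ S)))) ∎
    where
    open ℤ[x]-Reasoning
    E : ℕ → (List ℕ → ℤ) → Poly
    E = expansion hGap hTail
    merge : ∀ t → (hGap (t ∸ a) *P hExpansion t (λ S → A (t ∷ S))) ≈P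
                  ((hGap (t ∸ a) *P E t (λ T → flagH A (t ∷ T))) +P (hGap (t ∸ a) *P E t (flagH A)))
    merge t = ℤ[x].sym (ℤ[x].trans (ℤ[x].sym (ℤ[x].distribˡ (hGap (t ∸ a)) _ _))
      (*P-congˡ (hGap (t ∸ a)) (ℤ[x].trans (expansion-+ hGap hTail t (λ T → flagH A (t ∷ T)) (flagH A))
                                           (expansion-cong hGap hTail t λ {T} _ → flagH-∷ A t T))))

  -- both expansions satisfy the recursion of fExpansion-hRecursion, which determines them
  hExpansion≈fExpansion : ∀ {a} → a < r → ∀ A → hExpansion a A ≈P fExpansion a A
  hExpansion≈fExpansion {a} = go a (<-wellFounded (r ∸ a))
    where
    go : ∀ a → Acc _<_ (r ∸ a) → a < r → ∀ A → hExpansion a A ≈P fExpansion a A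
    go a (acc rec) a<r A = ∙-cancelʳ (∑[ t ← above a ] (hGap (t ∸ a) *P fExpansion t A)) _ _ (begin
      hExpansion a A +P (∑[ t ← above a ] (hGap (t ∸ a) *P fExpansion t A))
        ≈⟨ +P-congˡ (hExpansion a A) (∑-cong (above a) λ {t} t∈ → *P-congˡ (hGap (t ∸ a)) (ℤ[x].sym (IH t∈ A))) ⟩
      hExpansion a A +P (∑[ t ← above a ] (hGap (t ∸ a) *P hExpansion t A))
        ≈⟨ hExpansion-hRecursion a A ⟩
      (constP (A []) *P hTail (r ∸ a)) +P (∑[ s ← above a ] (hGap (s ∸ a) *P hExpansion s (λ S → A (s ∷ S))))
        ≈⟨ +P-congˡ (constP (A []) *P hTail (r ∸ a)) (∑-cong (above a) λ {s} s∈ →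
             *P-congˡ (hGap (s ∸ a)) (IH s∈ (λ S → A (s ∷ S)))) ⟩
      (constP (A []) *P hTail (r ∸ a)) +P (∑[ s ← above a ] (hGap (s ∸ a) *P fExpansion s (λ S → A (s ∷ S))))
        ≈⟨ fExpansion-hRecursion a<r A ⟨
      fExpansion a A +P (∑[ t ← above a ] (hGap (t ∸ a) *P fExpansion t A)) ∎)
      where
      open ℤ[x]-Reasoning
      IH : ∀ {t} → t ∈ above a → ∀ B → hExpansion t B ≈P fExpansion t B
      IH {t} t∈ with a<t , t<r ← ∈-⦅⦆⁻ a r t∈ = go t (rec (ℕP.∸-monoʳ-< a<t (ℕP.<⇒≤ t<r))) t<r

  separated : ℕ → List ℕ → Bool
  separated a []      = true
  separated a (t ∷ T) = not (suc a ≡ᵇ t) ∧ separated t T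

  t∸a≡2+ : ∀ {a t} → suc a < t → t ∸ a ≡ suc (suc (t ∸ suc (suc a)))
  t∸a≡2+ a+1<t = ≡.trans (∸-suc (ℕP.<-trans (ℕP.n<1+n _) a+1<t)) (cong suc (∸-suc a+1<t))

  separated-length : ∀ a T → T ∈ sublists (above a) → separated a T ≡ true → 2 ℕ.* length T ≤ r ∸ suc a
  separated-length a []      _  _   = ℕ.z≤n
  separated-length a (t ∷ T) T∈ sep with t∈ , T∈′ ← ∷∈sublists-⦅⦆ a r T∈ | suc a ≡ᵇ t in eq
  ... | false = begin
    2 ℕ.* suc (length T)              ≡⟨ ℕP.*-suc 2 (length T) ⟩
    2 ℕ.+ 2 ℕ.* length T              ≤⟨ ℕP.+-mono-≤ 2≤t∸a (separated-length t T T∈′ sep) ⟩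
    (t ∸ a) ℕ.+ (r ∸ suc t)           ≡⟨ ∸-split a<t t<r ⟨
    r ∸ suc a                         ∎
    where
    open ℕP.≤-Reasoning
    a<t : a < t
    a<t = proj₁ (∈-⦅⦆⁻ a r t∈)
    t<r : t < r
    t<r = proj₂ (∈-⦅⦆⁻ a r t∈)
    2≤t∸a : 2 ≤ t ∸ a
    2≤t∸a = ℕP.≤-trans (ℕ.s≤s (ℕ.s≤s ℕ.z≤n)) (ℕP.≤-reflexive (≡.sym (t∸a≡2+ (ℕP.≤∧≢⇒< a<t (≡ᵇ-false⇒≢ eq)))))

  exponent-step : ∀ {a t j} → suc a < t → t < r → 2 ℕ.* j ≤ r ∸ suc t →
    (t ∸ suc (suc a)) ℕ.+ ((r ∸ suc t) ∸ 2 ℕ.* j) ≡ (r ∸ suc a) ∸ 2 ℕ.* suc j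
  exponent-step {a} {t} {j} a+1<t t<r 2j≤ = begin
    m ℕ.+ (u ∸ 2 ℕ.* j)                       ≡⟨ ℕP.+-∸-assoc m 2j≤ ⟨
    (2 ℕ.+ (m ℕ.+ u)) ∸ (2 ℕ.+ 2 ℕ.* j)       ≡⟨ cong₂ _∸_ (cong (ℕ._+ u) (t∸a≡2+ a+1<t)) (ℕP.*-suc 2 j) ⟨
    ((t ∸ a) ℕ.+ u) ∸ 2 ℕ.* suc j             ≡⟨ cong (_∸ 2 ℕ.* suc j) (∸-split (ℕP.<-trans (ℕP.n<1+n a) a+1<t) t<r) ⟨
    (r ∸ suc a) ∸ 2 ℕ.* suc j                 ∎
    where
    open ≡.≡-Reasoning
    m : ℕ
    m = t ∸ suc (suc a)
    u : ℕ
    u = r ∸ suc t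

  hWeight-closed : ∀ a T → T ∈ sublists (above a) →
    weight hGap hTail a T ≈P (if separated a T then γTerm (length T) ((r ∸ suc a) ∸ 2 ℕ.* length T) else 0P)
  hWeight-closed a []      _  k = ≡.trans (cong (λ m → (onePlusX ^P m) k) r∸a∸1) (≡.sym (xP^-*P-+ 0 (onePlusX ^P (r ∸ suc a)) k))
    where
    r∸a∸1 : r ∸ a ∸ 1 ≡ r ∸ suc a
    r∸a∸1 = ≡.trans (ℕP.∸-+-assoc r a 1) (cong (r ∸_) (ℕP.+-comm a 1))
  hWeight-closed a (t ∷ T) T∈ with t∈ , T∈′ ← ∷∈sublists-⦅⦆ a r T∈ | suc a ≡ᵇ t in eq
  ... | true = ℤ[x].trans (*P-congʳ (weight hGap hTail t T) (ℤ[x].reflexive (cong hGap t∸a≡1))) (ℤ[x].zeroˡ (weight hGap hTail t T))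
    where
    t∸a≡1 : t ∸ a ≡ 1
    t∸a≡1 = ≡.trans (cong (_∸ a) (≡.sym (ℕP.≡ᵇ⇒≡ (suc a) t (≡.subst Tᵇ (≡.sym eq) tt)))) (ℕP.m+n∸n≡m 1 a)
  ... | false with separated t T in sep | hWeight-closed t T T∈′
  ...   | false | IH = ℤ[x].trans (*P-congˡ (hGap (t ∸ a)) IH) (ℤ[x].zeroʳ (hGap (t ∸ a)))
  ...   | true  | IH = begin
    hGap (t ∸ a) *P weight hGap hTail t T
      ≈⟨ *P-cong (ℤ[x].reflexive (cong hGap (t∸a≡2+ a+1<t))) IH ⟩
    hGap (suc (suc (t ∸ suc (suc a)))) *P γTerm (length T) ((r ∸ suc t) ∸ 2 ℕ.* length T)
      ≈⟨ hGap-*P-γTerm (t ∸ suc (suc a)) (length T) _ ⟩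
    γTerm (suc (length T)) ((t ∸ suc (suc a)) ℕ.+ ((r ∸ suc t) ∸ 2 ℕ.* length T))
      ≡⟨ cong (γTerm (suc (length T))) (exponent-step a+1<t t<r (separated-length t T T∈′ sep)) ⟩
    γTerm (suc (length T)) ((r ∸ suc a) ∸ 2 ℕ.* suc (length T)) ∎
    where
    open ℤ[x]-Reasoning
    t<r : t < r
    t<r = proj₂ (∈-⦅⦆⁻ a r t∈)
    a+1<t : suc a < t
    a+1<t = ℕP.≤∧≢⇒< (proj₁ (∈-⦅⦆⁻ a r t∈)) (≡ᵇ-false⇒≢ eq)

  noneConsecutive≡separated : ∀ a S → S ∈ sublists (above a) → noneConsecutive a S ≡ separated a S
  noneConsecutive≡separated a []      _  = refl
  noneConsecutive≡separated a (t ∷ T) S∈ with t∈ , T∈ ← ∷∈sublists-⦅⦆ a r S∈ = begin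
    not ((suc a ≡ᵇ t) ∨ elemℕ (suc a) T) ∧ (not ((suc t ≡ᵇ t) ∨ elemℕ (suc t) T) ∧ all (λ i → not ((suc i ≡ᵇ t) ∨ elemℕ (suc i) T)) T)
      ≡⟨ cong₂ (λ b c → not ((suc a ≡ᵇ t) ∨ b) ∧ (not (c ∨ elemℕ (suc t) T) ∧ all (λ i → not ((suc i ≡ᵇ t) ∨ elemℕ (suc i) T)) T))
           (elemℕ-false (All.map (ℕP.≤-<-trans a<t) T>t)) (≢⇒≡ᵇ-false (ℕP.>⇒≢ (ℕP.n<1+n t))) ⟩
    not ((suc a ≡ᵇ t) ∨ false) ∧ (not (elemℕ (suc t) T) ∧ all (λ i → not ((suc i ≡ᵇ t) ∨ elemℕ (suc i) T)) T)
      ≡⟨ cong₂ (λ b c → not b ∧ (not (elemℕ (suc t) T) ∧ c)) (∨-identityʳ (suc a ≡ᵇ t)) (all-drop T>t) ⟩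
    not (suc a ≡ᵇ t) ∧ noneConsecutive t T
      ≡⟨ cong (not (suc a ≡ᵇ t) ∧_) (noneConsecutive≡separated t T T∈) ⟩
    not (suc a ≡ᵇ t) ∧ separated t T ∎
    where
    open ≡.≡-Reasoning
    a<t : a < t
    a<t = proj₁ (∈-⦅⦆⁻ a r t∈)
    T>t : All (t <_) T
    T>t = All-<-sublists-⦅⦆ t r T∈
    all-drop : ∀ {U} → All (t <_) U → all (λ i → not ((suc i ≡ᵇ t) ∨ elemℕ (suc i) T)) U ≡ all (λ i → not (elemℕ (suc i) T)) U
    all-drop []            = refl
    all-drop {i ∷ _} (t<i ∷ t<U) = cong₂ (λ b c → not (b ∨ elemℕ (suc i) T) ∧ c)
      (≢⇒≡ᵇ-false (ℕP.<⇒≢ (ℕP.<-trans t<i (ℕP.n<1+n i)) ∘′ ≡.sym)) (all-drop t<U)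

  halfRank : ℕ
  halfRank = (r ∸ 1) / 2

  -- goodPoly P is goodSum (β P) for r = rank P, and β P is flagH applied to α P
  goodSum : (List ℕ → ℤ) → ℕ → ℤ
  goodSum B k = ℤ∑.∑ (filterᵇ (λ S → good S ∧ (length S ≡ᵇ k)) (sublists (range1 r))) B

  above-0 : above 0 ≡ range1 r
  above-0 = segment-0 (r ∸ 1)

  good-length : ∀ {S} → S ∈ sublists (range1 r) → good S ≡ true → length S ≤ halfRank
  good-length {S} S∈ gS = begin
    length S               ≡⟨ m*n/n≡m (length S) 2 ⟨
    length S ℕ.* 2 / 2     ≤⟨ /-monoˡ-≤ 2 (ℕP.≤-trans (ℕP.≤-reflexive (ℕP.*-comm (length S) 2))
                                (separated-length 0 S S∈′ (≡.trans (≡.sym (noneConsecutive≡separated 0 S S∈′)) gS))) ⟩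
    halfRank               ∎
    where
    open ℕP.≤-Reasoning
    S∈′ : S ∈ sublists (above 0)
    S∈′ = ≡.subst (λ L → S ∈ sublists L) (≡.sym above-0) S∈

  basis : ℕ → Poly
  basis i = γTerm i (r ∸ 1 ∸ 2 ℕ.* i)

  weight-good : ∀ S → S ∈ sublists (above 0) → weight hGap hTail 0 S ≈P (if good S then basis (length S) else 0P)
  weight-good S S∈ = ℤ[x].trans (hWeight-closed 0 S S∈)
    (ℤ[x].reflexive (cong (λ b → if b then basis (length S) else 0P) (≡.sym (noneConsecutive≡separated 0 S S∈))))

  basis-as-∑ : ∀ S → S ∈ sublists (range1 r) → ∀ c → (constP c *P (if good S then basis (length S) else 0P)) ≈P
           (∑[ i ← upTo (suc halfRank) ] when (good S ∧ (length S ≡ᵇ i)) (constP c *P basis i))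
  basis-as-∑ S S∈ c with good S in gS
  ... | false = ℤ[x].trans (ℤ[x].zeroʳ (constP c)) (ℤ[x].sym (∑-zero (upTo (suc halfRank)) λ _ _ → refl))
  ... | true  = ℤ[x].sym (ℤ[x].trans
    (∑-unique (upTo⁺ (suc halfRank)) (∈-upTo⁺ (ℕ.s≤s (good-length S∈ gS)))
       λ {i} _ i≢ → ℤ[x].reflexive (cong (λ b → when b (constP c *P basis i)) (≢⇒≡ᵇ-false (i≢ ∘′ ≡.sym))))
    (ℤ[x].reflexive (cong (λ b → when b (constP c *P basis (length S))) (≡ᵇ-refl (length S)))))

  hExpansion-γ : ∀ A → hExpansion 0 A ≈P gammaExpansion r (goodSum (flagH A))
  hExpansion-γ A = begin
    hExpansion 0 A
      ≈⟨ ∑-cong (sublists (above 0)) (λ {S} S∈ → *P-congˡ (constP (flagH A S)) (weight-good S S∈)) ⟩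
    ∑[ S ← sublists (above 0) ] (constP (flagH A S) *P (if good S then basis (length S) else 0P))
      ≡⟨ cong (λ L → ∑[ S ← sublists L ] (constP (flagH A S) *P (if good S then basis (length S) else 0P))) above-0 ⟩
    ∑[ S ← sublists (range1 r) ] (constP (flagH A S) *P (if good S then basis (length S) else 0P))
      ≈⟨ ∑-cong (sublists (range1 r)) (λ {S} S∈ → basis-as-∑ S S∈ (flagH A S)) ⟩
    ∑[ S ← sublists (range1 r) ] ∑[ i ← upTo (suc halfRank) ] term S i
      ≈⟨ ∑-comm (sublists (range1 r)) (upTo (suc halfRank)) term ⟩
    ∑[ i ← upTo (suc halfRank) ] ∑[ S ← sublists (range1 r) ] term S i
      ≈⟨ ∑-cong (upTo (suc halfRank)) (λ {i} _ → collect i) ⟩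
    ∑[ i ← upTo (suc halfRank) ] (constP (goodSum (flagH A) i) *P basis i) ∎
    where
    open ℤ[x]-Reasoning
    term : List ℕ → ℕ → Poly
    term S i = when (good S ∧ (length S ≡ᵇ i)) (constP (flagH A S) *P basis i)
    collect : ∀ i → (∑[ S ← sublists (range1 r) ] term S i) ≈P (constP (goodSum (flagH A) i) *P basis i)
    collect i = begin
      ∑[ S ← sublists (range1 r) ] term S i
        ≈⟨ ∑-filterᵇ (λ S → good S ∧ (length S ≡ᵇ i)) (sublists (range1 r)) (λ S → constP (flagH A S) *P basis i) ⟨
      ∑[ S ← goodOfLength ] (constP (flagH A S) *P basis i)
        ≈⟨ *-distribʳ-∑ (basis i) goodOfLength (λ S → constP (flagH A S)) ⟨
      (∑[ S ← goodOfLength ] constP (flagH A S)) *P basis i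
        ≈⟨ *P-congʳ (basis i) (constP-∑ goodOfLength (flagH A)) ⟨
      constP (goodSum (flagH A) i) *P basis i ∎
      where
      goodOfLength : List (List ℕ)
      goodOfLength = filterᵇ (λ S → good S ∧ (length S ≡ᵇ i)) (sublists (range1 r))

  basis-below : ∀ {i k} → k < i → basis i k ≡ + 0
  basis-below {i} k<i = xP^-*P-< i (onePlusX ^P (r ∸ 1 ∸ 2 ℕ.* i)) k<i

  basis-diagonal : ∀ k → basis k k ≡ + 1
  basis-diagonal k = ≡.trans (cong (basis k) (≡.sym (ℕP.+-identityʳ k)))
    (≡.trans (xP^-*P-+ k (onePlusX ^P (r ∸ 1 ∸ 2 ℕ.* k)) 0) (onePlusX^P-constant (r ∸ 1 ∸ 2 ℕ.* k)))

  gammaExpansion-coeff : ∀ γ k → gammaExpansion r γ k ≡ ℤ∑.∑[ i ← upTo (suc halfRank) ] (γ i * basis i k)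
  gammaExpansion-coeff γ k = ≡.trans (∑-coeff (upTo (suc halfRank)) (λ i → constP (γ i) *P basis i) k)
    (ℤ∑.∑-cong (upTo (suc halfRank)) λ {i} _ → constP-*P (γ i) (basis i) k)

  gammaExpansion-injective : ∀ {γ γ′} → gammaExpansion r γ ≈P gammaExpansion r γ′ → ∀ {k} → k ≤ halfRank → γ k ≡ γ′ k
  gammaExpansion-injective {γ} {γ′} γ≈γ′ {k} = go k (<-wellFounded k)
    where
    go : ∀ k → Acc _<_ k → k ≤ halfRank → γ k ≡ γ′ k
    go k (acc rec) k≤halfRank = ℤP.i-j≡0⇒i≡j (γ k) (γ′ k) (begin
      γ k - γ′ k                                          ≡⟨ ℤP.*-identityʳ (γ k - γ′ k) ⟨
      (γ k - γ′ k) * + 1                                  ≡⟨ cong ((γ k - γ′ k) *_) (basis-diagonal k) ⟨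
      (γ k - γ′ k) * basis k k                            ≡⟨ ℤ∑.∑-unique (upTo⁺ (suc halfRank)) (∈-upTo⁺ (ℕ.s≤s k≤halfRank)) others ⟨
      ℤ∑.∑[ i ← upTo (suc halfRank) ] ((γ i - γ′ i) * basis i k)
        ≡⟨ ℤ∑.∑-cong (upTo (suc halfRank)) (λ {i} _ → split (γ i) (γ′ i) (basis i k)) ⟩
      ℤ∑.∑[ i ← upTo (suc halfRank) ] (γ i * basis i k + - + 1 * (γ′ i * basis i k))
        ≡⟨ ℤ∑.∑-distrib-∙ (upTo (suc halfRank)) (λ i → γ i * basis i k) (λ i → - + 1 * (γ′ i * basis i k)) ⟩
      ℤ∑.∑[ i ← upTo (suc halfRank) ] (γ i * basis i k) + ℤ∑.∑[ i ← upTo (suc halfRank) ] (- + 1 * (γ′ i * basis i k))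
        ≡⟨ cong₂ _+_ (≡.trans (≡.sym (gammaExpansion-coeff γ k)) (≡.trans (γ≈γ′ k) (gammaExpansion-coeff γ′ k)))
                     (≡.sym (ℤ∑.*-distribˡ-∑ (- + 1) (upTo (suc halfRank)) (λ i → γ′ i * basis i k))) ⟩
      X + - + 1 * X                                       ≡⟨ cancel X ⟩
      + 0 ∎)
      where
      open ≡.≡-Reasoning
      X : ℤ
      X = ℤ∑.∑[ i ← upTo (suc halfRank) ] (γ′ i * basis i k)
      split : ∀ a b c → (a - b) * c ≡ a * c + - + 1 * (b * c)
      split = solve-∀
      cancel : ∀ x → x + - + 1 * x ≡ + 0
      cancel = solve-∀
      others : ∀ {i} → i ∈ upTo (suc halfRank) → i ≢ k → (γ i - γ′ i) * basis i k ≡ + 0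
      others {i} i∈ i≢k with ℕP.<-cmp i k
      ... | tri< i<k _ _ = ≡.trans (cong (_* basis i k) (ℤP.i≡j⇒i-j≡0 (go i (rec i<k) (ℕP.≤-trans (ℕP.<⇒≤ i<k) k≤halfRank))))
                                   (ℤP.*-zeroˡ (basis i k))
      ... | tri≈ _ i≡k _ = ⊥-elim (i≢k i≡k)
      ... | tri> _ _ k<i = ≡.trans (cong ((γ i - γ′ i) *_) (basis-below k<i)) (ℤP.*-zeroʳ (γ i - γ′ i))

  gammaPoly-cong : ∀ {γ γ′} → gammaExpansion r γ ≈P gammaExpansion r γ′ → gammaPoly r γ ≈P gammaPoly r γ′
  gammaPoly-cong {γ} {γ′} γ≈γ′ k with k ℕ.≤ᵇ halfRank in k≤ᵇM
  ... | true  = gammaExpansion-injective {γ} {γ′} γ≈γ′ (ℕP.≤ᵇ⇒≤ k halfRank (≡.subst Tᵇ (≡.sym k≤ᵇM) tt))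
  ... | false = refl

  gammaPoly-goodSum : ∀ B → gammaPoly r (goodSum B) ≈P goodSum B
  gammaPoly-goodSum B k with k ℕ.≤ᵇ halfRank in k≤ᵇM
  ... | true  = refl
  ... | false = ≡.sym (≡.trans (ℤ∑.∑-filterᵇ (λ S → good S ∧ (length S ≡ᵇ k)) (sublists (range1 r)) B) (ℤ∑.∑-zero (sublists (range1 r)) vanish))
    where
    vanish : ∀ {S} → S ∈ sublists (range1 r) → ℤ∑.when (good S ∧ (length S ≡ᵇ k)) (B S) ≡ + 0
    vanish {S} S∈ with good S in gS | length S ≡ᵇ k in lS
    ... | false | _     = refl
    ... | true  | false = refl
    ... | true  | true  = ⊥-elim (≡.subst Tᵇ k≤ᵇM (ℕP.≤⇒≤ᵇ (≡.subst (_≤ halfRank) (ℕP.≡ᵇ⇒≡ (length S) k (≡.subst Tᵇ (≡.sym lS) tt))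
                                                                      (good-length S∈ gS))))

-- The χ-Chow function

module Chow (P : GradedBoundedPoset) where
  open GradedBoundedPoset P
  open IsDecPartialOrder isDecPO using (_≟_; _≤?_) renaming (refl to ≼-refl)
  open Intervals P

  size-shrink-halfOpenInt : ∀ {s t w} → w ∈ halfOpenInt P s t → size s w < size s t
  size-shrink-halfOpenInt w∈ = let s≼w , w≼t , w≢t = ∈-halfOpenInt⁻ w∈ in size-shrinkʳ s≼w w≼t w≢t

  möbiusF-stable : ∀ f g {s t} → size s t < f → size s t < g → möbiusF P f s t ≡ möbiusF P g s t
  möbiusF-stable (suc f) (suc g) {s} {t} s<f s<g with s ≟ t
  ... | yes _ = refl
  ... | no _ with s ≤? t
  ...   | no _  = refl
  ...   | yes _ = cong -_ (ℤ∑.∑-cong (halfOpenInt P s t) λ w∈ →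
                    möbiusF-stable f g (ℕP.<-≤-trans (size-shrink-halfOpenInt w∈) (ℕP.≤-pred s<f)) (ℕP.<-≤-trans (size-shrink-halfOpenInt w∈) (ℕP.≤-pred s<g)))

  μ-refl : ∀ t → μ P t t ≡ + 1
  μ-refl t with t ≟ t
  ... | yes _  = refl
  ... | no t≢t = ⊥-elim (t≢t refl)

  μ-rec : ∀ {s t} → s ≼ t → s ≢ t → μ P s t ≡ - ℤ∑.∑ (halfOpenInt P s t) (μ P s)
  μ-rec {s} {t} s≼t s≢t with s ≟ t
  ... | yes s≡t = ⊥-elim (s≢t s≡t)
  ... | no _ with s ≤? t
  ...   | no s⋠t = ⊥-elim (s⋠t s≼t)
  ...   | yes _  = cong -_ (ℤ∑.∑-cong (halfOpenInt P s t) λ w∈ →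
                     möbiusF-stable n (suc n) (ℕP.<-≤-trans (size-shrink-halfOpenInt w∈) (size≤n s t)) (ℕP.m≤n⇒m≤1+n (ℕP.<-≤-trans (size-shrink-halfOpenInt w∈) (size≤n s t))))

  module _ where
    open Convolution P ℤP.+-*-commutativeRing
    open IntervalSums ℤP.+-0-commutativeMonoid

    μ-⊛-ζ : ∀ {s t} → s ≼ t → (μ P ⊛ ζ) s t ≡ δ s t
    μ-⊛-ζ {s} {t} s≼t with s ≟ t
    ... | yes refl = ≡.trans (∑-closedInt-refl s (λ w → μ P s w * + 1)) (≡.trans (ℤP.*-identityʳ _) (μ-refl s))
    ... | no s≢t = begin
      (μ P ⊛ ζ) s t                                                   ≡⟨ ∑-closedInt-top s≼t (λ w → μ P s w * + 1) ⟩
      ℤ∑.∑[ w ← halfOpenInt P s t ] (μ P s w * + 1) + μ P s t * + 1  ≡⟨ cong₂ _+_ (ℤ∑.∑-cong (halfOpenInt P s t) λ {w} _ → ℤP.*-identityʳ (μ P s w))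
                                                                                    (≡.trans (ℤP.*-identityʳ (μ P s t)) (μ-rec s≼t s≢t)) ⟩
      ℤ∑.∑ (halfOpenInt P s t) (μ P s) + - ℤ∑.∑ (halfOpenInt P s t) (μ P s) ≡⟨ ℤP.+-inverseʳ (ℤ∑.∑ (halfOpenInt P s t) (μ P s)) ⟩
      + 0 ∎
      where open ≡.≡-Reasoning

    ζ-⊛-μ : ∀ {s t} → s ≼ t → (ζ ⊛ μ P) s t ≡ δ s t
    ζ-⊛-μ = ⊛-inverseʳ ζ (μ P) (λ _ → + 1) (λ _ → refl) μ-⊛-ζ

    xρ : ℕ → Fin n → Fin n → ℤ
    xρ j w t = xP^ (ρ t ∸ ρ w) j

    χ-coeff : ∀ s t j → χ P s t j ≡ (μ P ⊛ xρ j) s t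
    χ-coeff s t j = ≡.trans (∑-coeff (closedInt P s t) (λ w → constP (μ P s w) *P xP^ (ρ t ∸ ρ w)) j)
      (ℤ∑.∑-cong (closedInt P s t) λ {w} _ → constP-*P (μ P s w) (xP^ (ρ t ∸ ρ w)) j)

    ∑-χ-coeff : ∀ {s t} → s ≼ t → ∀ j → ℤ∑.∑[ v ← closedInt P s t ] χ P v t j ≡ xP^ (ρ t ∸ ρ s) j
    ∑-χ-coeff {s} {t} s≼t j = begin
      ℤ∑.∑[ v ← closedInt P s t ] χ P v t j             ≡⟨ ℤ∑.∑-cong (closedInt P s t) (λ {v} _ → ≡.trans (χ-coeff v t j) (≡.sym (ℤP.*-identityˡ _))) ⟩
      (ζ ⊛ (μ P ⊛ xρ j)) s t                             ≡⟨ ⊛-assoc ζ (μ P) (xρ j) s t ⟨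
      ((ζ ⊛ μ P) ⊛ xρ j) s t                             ≡⟨ ℤ∑.∑-cong (closedInt P s t) (λ {w} w∈ → cong (_* xρ j w t) (ζ-⊛-μ (proj₁ (∈-closedInt⁻ w∈)))) ⟩
      (δ ⊛ xρ j) s t                                     ≡⟨ ⊛-identityˡ (xρ j) s≼t ⟩
      xρ j s t ∎
      where open ≡.≡-Reasoning

  χbar-≢ : ∀ {v t} → v ≢ t → χbar P v t ≡ divXm1 (χ P v t)
  χbar-≢ {v} {t} v≢t with v ≟ t
  ... | yes v≡t = ⊥-elim (v≢t v≡t)
  ... | no _    = refl

  χbar-refl : ∀ t → χbar P t t ≡ constP (- + 1)
  χbar-refl t with t ≟ t
  ... | yes _  = refl
  ... | no t≢t = ⊥-elim (t≢t refl)

  ∑-halfOpenInt-χ : ∀ {s t} → s ≼ t → ℤ[x]∑.∑ (halfOpenInt P s t) (λ v → χ P v t) ≈P (xP^ (ρ t ∸ ρ s) +P negP (xP^ 0))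
  ∑-halfOpenInt-χ {s} {t} s≼t j = begin
    ℤ[x]∑.∑ (halfOpenInt P s t) (λ v → χ P v t) j
      ≡⟨ ∑-coeff (halfOpenInt P s t) (λ v → χ P v t) j ⟩
    ℤ∑.∑[ v ← halfOpenInt P s t ] χ P v t j
      ≡⟨ cancel _ (χ P t t j) ⟩
    (ℤ∑.∑[ v ← halfOpenInt P s t ] χ P v t j + χ P t t j) + - χ P t t j
      ≡⟨ cong₂ (λ a b → a + - b) (≡.trans (≡.sym (∑-closedInt-top s≼t (λ v → χ P v t j))) (∑-χ-coeff s≼t j)) χ-diagonal ⟩
    xP^ (ρ t ∸ ρ s) j + - xP^ 0 j ∎
    where
    open ≡.≡-Reasoning
    open IntervalSums ℤP.+-0-commutativeMonoid
    cancel : ∀ a b → a ≡ (a + b) + - b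
    cancel = solve-∀
    χ-diagonal : χ P t t j ≡ xP^ 0 j
    χ-diagonal = ≡.trans (≡.sym (∑-closedInt-refl t (λ v → χ P v t j)))
                         (≡.trans (∑-χ-coeff ≼-refl j) (cong (λ m → xP^ m j) (ℕP.n∸n≡0 (ρ t))))

  open Convolution P ℤ[x]-commutativeRing
  open RingProperties ℤ[x].ring using (-‿distribˡ-*)
  open IntervalSums ℤ[x].+-commutativeMonoid

  ζ-⊛-χbar : ∀ {s t} → s ≼ t → s ≢ t → (ζ ⊛ χbar P) s t ≈P fGap (ρ t ∸ ρ s)
  ζ-⊛-χbar {s} {t} s≼t s≢t = begin
    (ζ ⊛ χbar P) s t
      ≈⟨ ∑-closedInt-top s≼t (λ v → 1P *P χbar P v t) ⟩
    (ℤ[x]∑.∑[ v ← halfOpenInt P s t ] (1P *P χbar P v t)) +P (1P *P χbar P t t)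
      ≈⟨ +P-cong (ℤ[x]∑.∑-cong (halfOpenInt P s t) λ v∈ → ℤ[x].trans (ℤ[x].*-identityˡ _)
                    (ℤ[x].reflexive (χbar-≢ (proj₂ (proj₂ (∈-halfOpenInt⁻ v∈))))))
                 (ℤ[x].trans (ℤ[x].*-identityˡ _) (ℤ[x].reflexive (χbar-refl t))) ⟩
    (ℤ[x]∑.∑[ v ← halfOpenInt P s t ] divXm1 (χ P v t)) +P constP (- + 1)
      ≈⟨ +P-congʳ (constP (- + 1)) (divXm1-∑ (halfOpenInt P s t) (λ v → χ P v t)) ⟨
    divXm1 (ℤ[x]∑.∑ (halfOpenInt P s t) (λ v → χ P v t)) +P constP (- + 1)
      ≈⟨ +P-congʳ (constP (- + 1)) (divXm1-cong (∑-halfOpenInt-χ s≼t)) ⟩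
    divXm1 (xP^ (ρ t ∸ ρ s) +P negP (xP^ 0)) +P constP (- + 1)
      ≈⟨ divXm1-xᵈ-1 (ℕP.m<n⇒0<n∸m (ρ-mono s≼t s≢t)) ⟩
    fGap (ρ t ∸ ρ s) ∎
    where open ℤ[x]-Reasoning

  invF-stable : ∀ a f g {s t} → size s t < f → size s t < g → invF P a f s t ≈P invF P a g s t
  invF-stable a (suc f) (suc g) {s} {t} s<f s<g with s ≟ t
  ... | yes _ = λ _ → refl
  ... | no _ with s ≤? t
  ...   | no _  = λ _ → refl
  ...   | yes _ = ℤ[x]∑.∑-cong (halfOpenInt P s t) λ {w} w∈ → *P-congʳ (a w t)
                    (invF-stable a f g (ℕP.<-≤-trans (size-shrink-halfOpenInt w∈) (ℕP.≤-pred s<f)) (ℕP.<-≤-trans (size-shrink-halfOpenInt w∈) (ℕP.≤-pred s<g)))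

  χbarInv-refl : ∀ t → χbarInv P t t ≡ constP (- + 1)
  χbarInv-refl t with t ≟ t
  ... | yes _  = refl
  ... | no t≢t = ⊥-elim (t≢t refl)

  χbarInv-rec : ∀ {s t} → s ≼ t → s ≢ t →
    χbarInv P s t ≈P (ℤ[x]∑.∑[ w ← halfOpenInt P s t ] (χbarInv P s w *P χbar P w t))
  χbarInv-rec {s} {t} s≼t s≢t with s ≟ t
  ... | yes s≡t = ⊥-elim (s≢t s≡t)
  ... | no _ with s ≤? t
  ...   | no s⋠t = ⊥-elim (s⋠t s≼t)
  ...   | yes _  = ℤ[x]∑.∑-cong (halfOpenInt P s t) λ {w} w∈ → *P-congʳ (χbar P w t)
                     (invF-stable (χbar P) n (suc n) (ℕP.<-≤-trans (size-shrink-halfOpenInt w∈) (size≤n s t))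
                                  (ℕP.m≤n⇒m≤1+n (ℕP.<-≤-trans (size-shrink-halfOpenInt w∈) (size≤n s t))))

  -1*P : ∀ p → (p *P constP (- + 1)) ≈P negP p
  -1*P p k = ≡.trans (*P-comm p (constP (- + 1)) k) (≡.trans (constP-*P (- + 1) p k) (ℤP.-1*i≡-i (p k)))

  χbarInv-⊛-χbar : ∀ {s t} → s ≼ t → (χbarInv P ⊛ χbar P) s t ≈P δ s t
  χbarInv-⊛-χbar {s} {t} s≼t with s ≟ t
  ... | yes refl = ℤ[x].trans (∑-closedInt-refl s (λ w → χbarInv P s w *P χbar P w s))
    (ℤ[x].trans (ℤ[x].reflexive (cong₂ _*P_ (χbarInv-refl s) (χbar-refl s)))
                (ℤ[x].trans (-1*P (constP (- + 1))) λ { zero → refl ; (suc _) → refl }))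
  ... | no s≢t = begin
    (χbarInv P ⊛ χbar P) s t
      ≈⟨ ∑-closedInt-top s≼t (λ w → χbarInv P s w *P χbar P w t) ⟩
    (ℤ[x]∑.∑[ w ← halfOpenInt P s t ] (χbarInv P s w *P χbar P w t)) +P (χbarInv P s t *P χbar P t t)
      ≈⟨ +P-cong (ℤ[x].sym (χbarInv-rec s≼t s≢t)) (ℤ[x].trans (ℤ[x].reflexive (cong (χbarInv P s t *P_) (χbar-refl t))) (-1*P _)) ⟩
    χbarInv P s t +P negP (χbarInv P s t)
      ≈⟨ ℤ[x].-‿inverseʳ (χbarInv P s t) ⟩
    0P ∎
    where open ℤ[x]-Reasoning

  χbar-⊛-χbarInv : ∀ {s t} → s ≼ t → (χbar P ⊛ χbarInv P) s t ≈P δ s t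
  χbar-⊛-χbarInv = ⊛-inverseʳ (χbar P) (χbarInv P) (λ _ → constP (- + 1))
    (λ t → ℤ[x].trans (ℤ[x].reflexive (cong (constP (- + 1) *P_) (χbar-refl t)))
                      (ℤ[x].trans (-1*P (constP (- + 1))) λ { zero → refl ; (suc _) → refl }))
    χbarInv-⊛-χbar

  H-top : Hfun P top top ≈P 1P
  H-top = ℤ[x].trans (λ k → cong (λ p → - p k) (χbarInv-refl top)) λ { zero → refl ; (suc _) → refl }

  -- ψ(s,s) = 1 and ψ(s,t) = −(x + ⋯ + x^(ρ(s,t)−1)) for s < t, by ζ-⊛-χbar
  ψ : Fin n → Fin n → Poly
  ψ s t = negP ((ζ ⊛ χbar P) s t)

  ψ-⊛-H : ∀ {s t} → s ≼ t → (ψ ⊛ Hfun P) s t ≈P 1P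
  ψ-⊛-H {s} {t} s≼t = begin
    (ψ ⊛ Hfun P) s t                        ≈⟨ neg-⊛-neg (ζ ⊛ χbar P) (χbarInv P) s t ⟩
    ((ζ ⊛ χbar P) ⊛ χbarInv P) s t          ≈⟨ ⊛-assoc ζ (χbar P) (χbarInv P) s t ⟩
    (ζ ⊛ (χbar P ⊛ χbarInv P)) s t          ≈⟨ ℤ[x]∑.∑-cong (closedInt P s t) (λ {w} w∈ →
                                                 *P-congˡ 1P (χbar-⊛-χbarInv (proj₂ (∈-closedInt⁻ w∈)))) ⟩
    (ζ ⊛ δ) s t                              ≈⟨ ⊛-identityʳ ζ s≼t ⟩
    1P ∎
    where open ℤ[x]-Reasoning

  H-rec : ∀ s → Hfun P s top ≈P (1P +P (ℤ[x]∑.∑[ u ← leftOpenInt s top ] (fGap (ρ u ∸ ρ s) *P Hfun P u top)))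
  H-rec s k = solve-for-h (≡.trans (≡.sym (ψ-⊛-H (top-great s) k)) (≡.trans (∑-closedInt-bot (top-great s) (λ u → ψ s u *P Hfun P u top) k)
                (cong₂ _+_ (upper k) (ψ-diagonal k))))
    where
    X : Poly
    X = ℤ[x]∑.∑[ u ← leftOpenInt s top ] (fGap (ρ u ∸ ρ s) *P Hfun P u top)
    upper : (ℤ[x]∑.∑[ u ← leftOpenInt s top ] (ψ s u *P Hfun P u top)) ≈P negP X
    upper = ℤ[x].trans (ℤ[x]∑.∑-cong (leftOpenInt s top) (λ {u} u∈ → let s≼u , _ , u≢s = ∈-leftOpenInt⁻ u∈ in
                ℤ[x].trans (*P-congʳ (Hfun P u top) (λ k → cong -_ (ζ-⊛-χbar s≼u (u≢s ∘ ≡.sym) k)))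
                           (ℤ[x].sym (-‿distribˡ-* (fGap (ρ u ∸ ρ s)) (Hfun P u top)))))
              (negP-∑ (leftOpenInt s top) (λ u → fGap (ρ u ∸ ρ s) *P Hfun P u top))
    ψ-diagonal : (ψ s s *P Hfun P s top) ≈P Hfun P s top
    ψ-diagonal = ℤ[x].trans (*P-congʳ (Hfun P s top) ψss≈1) (ℤ[x].*-identityˡ (Hfun P s top))
      where
      ψss≈1 : ψ s s ≈P 1P
      ψss≈1 = ℤ[x].trans (λ k → cong -_ (≡.trans (∑-closedInt-refl s (λ v → 1P *P χbar P v s) k)
                                          (≡.trans (ℤ[x].*-identityˡ (χbar P s s) k) (cong (λ p → p k) (χbar-refl s)))))
                         λ { zero → refl ; (suc _) → refl }
    solve-for-h : ∀ {a x h} → a ≡ - x + h → h ≡ a + x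
    solve-for-h {a} {x} {h} refl = solve h x
      where
      solve : ∀ h x → h ≡ (- x + h) + x
      solve = solve-∀

-- Expansion of the χ-Chow polynomial over chains

+-∑ℕ : {A : Set} (xs : List A) (f : A → ℕ) → + foldr ℕ._+_ 0 (map f xs) ≡ ℤ∑.∑[ x ← xs ] (+ f x)
+-∑ℕ []       f = refl
+-∑ℕ (x ∷ xs) f = ≡.trans (ℤP.pos-+ (f x) _) (cong (_+_ (+ f x)) (+-∑ℕ xs f))

module ChowExpansion (P : GradedBoundedPoset) where
  open GradedBoundedPoset P
  open IsDecPartialOrder isDecPO using (_≟_; _≤?_) renaming (refl to ≼-refl)
  open Intervals P
  open Chow P
  open Flags (rank P)
  open ℤ[x]∑ using (∑-filter-remove; ∑-filter-fibers)
  open ℤ[x]-Reasoning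

  r : ℕ
  r = rank P

  -- the elements summed over in chainsFrom s (b ∷ S)
  ofRank : Fin n → ℕ → List (Fin n)
  ofRank s b = filter (λ v → (s ≤? v) ×-dec ¬? (s ≟ v) ×-dec (ρ v ℕ.≟ b)) (allFin n)

  chainCount : Fin n → List ℕ → ℤ
  chainCount s S = + chainsFrom P s S

  chainCount-∷ : ∀ s b S → chainCount s (b ∷ S) ≡ ℤ∑.∑[ v ← ofRank s b ] chainCount v S
  chainCount-∷ s b S = +-∑ℕ (ofRank s b) (λ v → chainsFrom P v S)

  ρ<r : ∀ {u} → u ≢ top → ρ u < r
  ρ<r u≢top = ρ-mono (top-great _) u≢top

  ∑-leftOpenInt-top : ∀ {s} → s ≢ top → (f : Fin n → Poly) →
    (ℤ[x]∑.∑ (leftOpenInt s top) f) ≈P ((ℤ[x]∑.∑[ b ← above (ρ s) ] ℤ[x]∑.∑ (ofRank s b) f) +P f top)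
  ∑-leftOpenInt-top {s} s≢top f = ℤ[x].trans
    (∑-filter-remove (λ u → (s ≤? u) ×-dec (u ≤? top) ×-dec ¬? (u ≟ s)) (λ u → (s ≤? u) ×-dec ¬? (s ≟ u) ×-dec ¬? (u ≟ top))
       f (allFin⁺ n) (∈-allFin top) (top-great s , ≼-refl , s≢top ∘ ≡.sym) (λ (_ , _ , top≢top) → top≢top refl)
       (λ (s≼u , s≢u , _) → s≼u , top-great _ , s≢u ∘ ≡.sym) (λ (s≼u , _ , u≢s) u≢top → s≼u , u≢s ∘ ≡.sym , u≢top))
    (+P-congʳ (f top) (∑-filter-fibers _ (λ b v → (s ≤? v) ×-dec ¬? (s ≟ v) ×-dec (ρ v ℕ.≟ b)) ρ (segment-unique (ρ s) _)
       (λ (s≼u , s≢u , u≢top) → ∈-⦅⦆⁺ (ρ-mono s≼u s≢u) (ρ<r u≢top))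
       (λ b∈ → mk⇔ (λ (s≼u , s≢u , ρu≡b) → (s≼u , s≢u , λ { refl → ℕP.<-irrefl (≡.sym ρu≡b) (proj₂ (∈-⦅⦆⁻ (ρ s) r b∈)) }) , ρu≡b)
                   (λ ((s≼u , s≢u , _) , ρu≡b) → s≼u , s≢u , ρu≡b))
       (allFin n) f))

  fExpansion-top : ∀ c → fExpansion r c ≈P constP (c [])
  fExpansion-top c = begin
    fExpansion r c
      ≡⟨ cong (λ L → ℤ[x]∑.∑[ S ← sublists L ] (constP (c S) *P weight fGap fTail r S)) (⦅⦆-[] r r (ℕP.m≤n⇒m∸n≡0 (ℕP.n≤1+n r))) ⟩
    (constP (c []) *P fTail (r ∸ r)) +P 0P
      ≈⟨ ℤ[x].+-identityʳ _ ⟩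
    constP (c []) *P fTail (r ∸ r)
      ≈⟨ *P-congˡ (constP (c [])) (ℤ[x].trans (ℤ[x].reflexive (cong fTail (ℕP.n∸n≡0 r))) λ { zero → refl ; (suc _) → refl }) ⟩
    constP (c []) *P 1P
      ≈⟨ ℤ[x].*-identityʳ (constP (c [])) ⟩
    constP (c []) ∎

  ∑-ofRank : ∀ s b → (ℤ[x]∑.∑[ u ← ofRank s b ] (fGap (ρ u ∸ ρ s) *P fExpansion (ρ u) (chainCount u))) ≈P
                      (fGap (b ∸ ρ s) *P fExpansion b (λ S → chainCount s (b ∷ S)))
  ∑-ofRank s b = begin
    ℤ[x]∑.∑[ u ← ofRank s b ] (fGap (ρ u ∸ ρ s) *P fExpansion (ρ u) (chainCount u))
      ≈⟨ ℤ[x]∑.∑-cong (ofRank s b) (λ {u} u∈ → ℤ[x].reflexive (cong (λ m → fGap (m ∸ ρ s) *P fExpansion m (chainCount u))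
           (proj₂ (proj₂ (proj₂ (∈-filter⁻ (λ v → (s ≤? v) ×-dec ¬? (s ≟ v) ×-dec (ρ v ℕ.≟ b)) {xs = allFin n} u∈)))))) ⟩
    ℤ[x]∑.∑[ u ← ofRank s b ] (fGap (b ∸ ρ s) *P fExpansion b (chainCount u))
      ≈⟨ ℤ[x]∑.*-distribˡ-∑ (fGap (b ∸ ρ s)) (ofRank s b) _ ⟨
    fGap (b ∸ ρ s) *P (ℤ[x]∑.∑[ u ← ofRank s b ] fExpansion b (chainCount u))
      ≈⟨ *P-congˡ (fGap (b ∸ ρ s)) (expansion-∑ fGap fTail b (ofRank s b) chainCount) ⟨
    fGap (b ∸ ρ s) *P fExpansion b (λ S → ℤ∑.∑[ u ← ofRank s b ] chainCount u S)
      ≈⟨ *P-congˡ (fGap (b ∸ ρ s)) (expansion-cong fGap fTail b λ {S} _ → chainCount-∷ s b S) ⟨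
    fGap (b ∸ ρ s) *P fExpansion b (λ S → chainCount s (b ∷ S)) ∎

  H-expansion : ∀ s → Hfun P s top ≈P fExpansion (ρ s) (chainCount s)
  H-expansion s = go s (<-wellFounded (size s top))
    where
    E : Fin n → Poly
    E u = fExpansion (ρ u) (chainCount u)
    E-top : E top ≈P 1P
    E-top = fExpansion-top (chainCount top)
    go : ∀ s → Acc _<_ (size s top) → Hfun P s top ≈P E s
    go s (acc rec) = cases (s ≟ top)
      where
      X : Poly
      X = ℤ[x]∑.∑[ b ← above (ρ s) ] (fGap (b ∸ ρ s) *P fExpansion b (λ S → chainCount s (b ∷ S)))
      open CommutativeSemigroupProperties ℤ[x].+-commutativeSemigroup using (x∙yz≈xz∙y)
      cases : Dec (s ≡ top) → Hfun P s top ≈P E s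
      cases (yes s≡top) = ≡.subst (λ u → Hfun P u top ≈P E u) (≡.sym s≡top) (ℤ[x].trans H-top (ℤ[x].sym E-top))
      cases (no s≢top) = begin
        Hfun P s top
          ≈⟨ H-rec s ⟩
        1P +P (ℤ[x]∑.∑[ u ← leftOpenInt s top ] (fGap (ρ u ∸ ρ s) *P Hfun P u top))
          ≈⟨ +P-congˡ 1P (ℤ[x]∑.∑-cong (leftOpenInt s top) λ {u} u∈ → let s≼u , _ , u≢s = ∈-leftOpenInt⁻ u∈ in
               *P-congˡ (fGap (ρ u ∸ ρ s)) (go u (rec (size-shrinkˡ s≼u (top-great u) (u≢s ∘ ≡.sym))))) ⟩
        1P +P (ℤ[x]∑.∑[ u ← leftOpenInt s top ] (fGap (ρ u ∸ ρ s) *P E u))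
          ≈⟨ +P-congˡ 1P (∑-leftOpenInt-top s≢top (λ u → fGap (ρ u ∸ ρ s) *P E u)) ⟩
        1P +P ((ℤ[x]∑.∑[ b ← above (ρ s) ] ℤ[x]∑.∑[ u ← ofRank s b ] (fGap (ρ u ∸ ρ s) *P E u)) +P (fGap (r ∸ ρ s) *P E top))
          ≈⟨ +P-congˡ 1P (+P-cong (ℤ[x]∑.∑-cong (above (ρ s)) λ {b} _ → ∑-ofRank s b)
                                   (ℤ[x].trans (*P-congˡ (fGap (r ∸ ρ s)) E-top) (ℤ[x].*-identityʳ _))) ⟩
        1P +P (X +P fGap (r ∸ ρ s))
          ≈⟨ x∙yz≈xz∙y 1P X (fGap (r ∸ ρ s)) ⟩
        fTail (r ∸ ρ s) +P X
          ≈⟨ +P-congʳ X (ℤ[x].*-identityˡ (fTail (r ∸ ρ s))) ⟨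
        (constP (chainCount s []) *P fTail (r ∸ ρ s)) +P X
          ≈⟨ fExpansion-∷ (ρ s) (chainCount s) ⟨
        E s ∎

  chainCount-bot : ∀ {S} → S ∈ sublists (above 0) → chainCount bot S ≡ + α P S
  chainCount-bot {[]}    _   = refl
  chainCount-bot {b ∷ S} bS∈ = cong (λ vs → + foldr ℕ._+_ 0 (map (λ v → chainsFrom P v S) vs))
    (ListP.filter-≐ (λ v → (bot ≤? v) ×-dec ¬? (bot ≟ v) ×-dec (ρ v ℕ.≟ b)) (λ v → ρ v ℕ.≟ b)
              ((λ (_ , _ , ρv≡b) → ρv≡b) , λ {v} ρv≡b → bot-least v , (λ { refl → 0≢b (≡.trans (≡.sym ρ-bot) ρv≡b) }) , ρv≡b)
              (allFin n))
    where
    0≢b : 0 ≢ b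
    0≢b = ℕP.<⇒≢ (proj₁ (∈-⦅⦆⁻ 0 r (proj₁ (∷∈sublists-⦅⦆ 0 r bS∈))))

  H≈fExpansion-α : H P ≈P fExpansion 0 (λ S → + α P S)
  H≈fExpansion-α = begin
    H P                               ≈⟨ H-expansion bot ⟩
    fExpansion (ρ bot) (chainCount bot) ≡⟨ cong (λ a → fExpansion a (chainCount bot)) ρ-bot ⟩
    fExpansion 0 (chainCount bot)     ≈⟨ expansion-cong fGap fTail 0 chainCount-bot ⟩
    fExpansion 0 (λ S → + α P S) ∎

theorem4p25 : (P : GradedBoundedPoset) → 1 ≤ rank P
            → (γ : ℕ → ℤ) → H P ≈P gammaExpansion (rank P) γ
            → gammaPoly (rank P) γ ≈P goodPoly P
theorem4p25 P 1≤r γ H≈γ = ℤ[x].trans (gammaPoly-cong (ℤ[x].trans (ℤ[x].sym H≈γ) H≈goodPoly)) (gammaPoly-goodSum (β P))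
  where
  open ChowExpansion P
  open Flags (rank P)
  open ℤ[x]-Reasoning
  α′ : List ℕ → ℤ
  α′ S = + α P S
  H≈goodPoly : H P ≈P gammaExpansion (rank P) (goodPoly P)
  H≈goodPoly = begin
    H P                                       ≈⟨ H≈fExpansion-α ⟩
    fExpansion 0 α′                           ≈⟨ hExpansion≈fExpansion 1≤r α′ ⟨
    hExpansion 0 α′                           ≈⟨ hExpansion-γ α′ ⟩
    gammaExpansion (rank P) (goodPoly P) ∎
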